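{- Let $(G,u)$, $(H,v)$, $(J,w)$ be rooted graphs. Then for any integers $g,j\ge 0$ and $h\ge 1$, \[ X_{S^{ghj}(G,H,J)}=X_{S^{(g+j)h0}(G,H,J)}+\sum_{i=1}^{j}\Big(X_{P^{g+h+i-1}(G,H)}\,X_{J^{j-i}}-X_{G^{g+i-1}}\,X_{P^{h+j-i}(H,J)}\Big). \]
   Context: All graphs are finite simple graphs; $X_G=\sum_{\kappa}\prod_{v\in V(G)}x_{\kappa(v)}$ over proper colorings $\kappa:V(G)\to\{1,2,\dots\}$ is the chromatic symmetric function. For a weak composition $\tau=\tau_1\tau_2\tau_3$ (nonnegative integers), the spider $S(\tau)$ consists of a center vertex $c$ and three paths (legs) of lengths $\tau_1,\tau_2,\tau_3$ starting at $c$ and otherwise disjoint; $s_i$ is the far end of the $i$-th leg ($s_i=c$ if $\tau_i=0$). For rooted graphs $(G_i,u_i)$, $S^\tau(G_1,G_2,G_3)$ is obtained from $S(\tau)$ and disjoint copies of the $G_i$ by identifying $u_i$ with $s_i$. For rooted graphs $(G,u),(H,v)$ and $k\ge 0$, $P^k(G,H)$ is obtained from disjoint copies of $G,H$ by adding a path of length $k$ linking $u$ and $v$ (identifying them if $k=0$); the tailed graph is $G^k=P^k(G,K_1)$. -}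

module Defs where

open import Data.Nat using (ℕ; zero; suc; _+_; _∸_; _<_; _≡ᵇ_; _<ᵇ_)
open import Data.Integer as ℤ using (ℤ)
open import Data.Fin using (Fin; zero; suc)
open import Data.Fin.Properties using () renaming (_≟_ to _≟ᶠ_)
open import Data.Bool using (Bool; true; false; _∧_; if_then_else_; not)
open import Data.Maybe using (Maybe; just; nothing)
open import Data.Vec using (Vec; []; _∷_; zipWith)
open import Data.List using (List; []; _∷_; _++_; map; concatMap; upTo; allFin; length)
open import Data.List.Relation.Unary.All using (All)
open import Data.Product using (_×_; _,_; proj₁; proj₂)
open import Relation.Binary.PropositionalEquality using (_≡_; _≢_)
open import Relation.Nullary.Decidable using (⌊_⌋)

-- Finite graphs with vertex set {0,…,n-1} (labelled by naturals) and an
-- (undirected) edge list.  Multiplicities/orientation in the list are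
-- irrelevant.

record Graph : Set where
  constructor mkGraph
  field
    n     : ℕ
    edges : List (ℕ × ℕ)
open Graph public

Simple : Graph → Set
Simple G = All (λ e → (proj₁ e < n G) × (proj₂ e < n G) × (proj₁ e ≢ proj₂ e)) (edges G)

record Rooted : Set where
  constructor mkRooted
  field
    graph  : Graph
    root   : ℕ
    root<n : root < n graph
    simple : Simple graph
open Rooted public

K₁ : Rooted
K₁ = mkRooted (mkGraph 1 []) 0 (Data.Nat.s≤s Data.Nat.z≤n) All.[]

-- Placing a rooted graph inside a larger graph: its root goes to
-- position r, its other vertices (in order) to off, off+1, …
place : (G : Rooted) (r off : ℕ) → ℕ → ℕ
place G r off x =
  if x ≡ᵇ root G then r
  else (if x <ᵇ root G then off + x else off + (x ∸ 1))

placeEdges : (G : Rooted) (r off : ℕ) → List (ℕ × ℕ)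
placeEdges G r off = map (λ e → place G r off (proj₁ e) , place G r off (proj₂ e)) (edges (graph G))

rest : Rooted → ℕ
rest G = n (graph G) ∸ 1

pathEdges : (k : ℕ) (p : ℕ → ℕ) → List (ℕ × ℕ)
pathEdges k p = map (λ i → p i , p (suc i)) (upTo k)

-- P^k(G,H): G on 0…n_G-1, path p₀ = u, p_i = n_G + i - 1 (i ≥ 1),
-- root of H identified with p_k, other vertices of H from n_G + k on.
P : (k : ℕ) (G H : Rooted) → Graph
P k G H = mkGraph (n (graph G) + k + rest H)
  (edges (graph G) ++ pathEdges k p ++ placeEdges H (p k) (n (graph G) + k))
  where
  p : ℕ → ℕ
  p zero    = root G
  p (suc i) = n (graph G) + i

tailG : (G : Rooted) (k : ℕ) → Graph
tailG G k = P k G K₁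

-- S^{abc}(G₁,G₂,G₃): center 0; leg ℓ has vertices 0, base+1, …, base+len
-- with bases 0, a, a+b; spider has 1+a+b+c vertices; then the non-root
-- vertices of G₁, G₂, G₃ follow, their roots identified with the leg ends.
legV : (base : ℕ) → ℕ → ℕ
legV base zero    = 0
legV base (suc i) = base + suc i

Spider : (a b c : ℕ) (G₁ G₂ G₃ : Rooted) → Graph
Spider a b c G₁ G₂ G₃ =
  mkGraph (N + rest G₁ + rest G₂ + rest G₃)
    (pathEdges a (legV 0) ++ pathEdges b (legV a) ++ pathEdges c (legV (a + b))
     ++ placeEdges G₁ (legV 0 a) N
     ++ placeEdges G₂ (legV a b) (N + rest G₁)
     ++ placeEdges G₃ (legV (a + b) c) (N + rest G₁ + rest G₂))
  where
  N : ℕ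
  N = suc (a + b + c)

-- Every monomial involves only finitely many variables; a series is
-- given by its coefficient of x₁^{α₁}⋯x_k^{α_k} for every k and α ∈ ℕ^k.
Series : Set
Series = (k : ℕ) → Vec ℕ k → ℤ

infix 4 _≈_
_≈_ : Series → Series → Set
F ≈ G = ∀ k (α : Vec ℕ k) → F k α ≡ G k α

infixl 6 _⊕_ _⊖_
infixl 7 _⊛_

_⊕_ : Series → Series → Series
(F ⊕ G) k α = F k α ℤ.+ G k α

_⊖_ : Series → Series → Series
(F ⊖ G) k α = F k α ℤ.- G k α

𝟘 : Series
𝟘 k α = ℤ.0ℤ

sumℤ : List ℤ → ℤ
sumℤ []       = ℤ.0ℤ
sumℤ (x ∷ xs) = x ℤ.+ sumℤ xs

below : ∀ {k} → Vec ℕ k → List (Vec ℕ k)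
below []      = [] ∷ []
below (a ∷ α) = concatMap (λ b → map (b ∷_) (below α)) (upTo (suc a))

_⊛_ : Series → Series → Series
(F ⊛ G) k α = sumℤ (map (λ β → F k β ℤ.* G k (zipWith _∸_ α β)) (below α))

Σ[1to_]_ : ℕ → (ℕ → Series) → Series
Σ[1to zero ] F = 𝟘
Σ[1to suc j ] F = (Σ[1to j ] F) ⊕ F (suc j)

allVecs : (k n : ℕ) → List (Vec (Fin k) n)
allVecs k zero    = [] ∷ []
allVecs k (suc n) = concatMap (λ c → map (c ∷_) (allVecs k n)) (allFin k)

at : ∀ {A : Set} {n} → Vec A n → ℕ → Maybe A
at []       _       = nothing
at (x ∷ xs) zero    = just x
at (x ∷ xs) (suc i) = at xs i

sameColor : ∀ {k} → Maybe (Fin k) → Maybe (Fin k) → Bool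
sameColor (just c) (just d) = ⌊ c ≟ᶠ d ⌋
sameColor _        _        = true

properᵇ : ∀ {k n} → List (ℕ × ℕ) → Vec (Fin k) n → Bool
properᵇ []            κ = true
properᵇ ((x , y) ∷ E) κ = not (sameColor (at κ x) (at κ y)) ∧ properᵇ E κ

countColor : ∀ {k n} → Fin k → Vec (Fin k) n → ℕ
countColor c []      = 0
countColor c (d ∷ κ) = (if ⌊ c ≟ᶠ d ⌋ then 1 else 0) + countColor c κ

eqVecᵇ : ∀ {k} → Vec ℕ k → Vec ℕ k → Bool
eqVecᵇ []      []      = true
eqVecᵇ (a ∷ α) (b ∷ β) = (a ≡ᵇ b) ∧ eqVecᵇ α β

colorCounts : ∀ {k n} → Vec (Fin k) n → Vec ℕ k
colorCounts {k} κ = Data.Vec.tabulate (λ c → countColor c κ)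

countᵇ : ∀ {A : Set} → (A → Bool) → List A → ℕ
countᵇ p []       = 0
countᵇ p (x ∷ xs) = (if p x then 1 else 0) + countᵇ p xs

X : Graph → Series
X G k α = ℤ.+ countᵇ (λ κ → properᵇ (edges G) κ ∧ eqVecᵇ (colorCounts κ) α) (allVecs k (n G))

-- Triple deletion (Orellana–Scott) on the triangle formed by the centre of S(g, h, j+1) and the first
-- vertices v₂, v₃ of its second and third legs gives
--   X_{S(g,h,j+1)} = X_{S(g+1,h,j)} + X_{P^{g+h}(G,H)} X_{J^j} − X_{G^g} X_{P^{h+j}(H,J)} :
-- trading the edge centre–v₂ for v₃–v₂ gives S(g+1, h, j) centred at v₃, deleting centre–v₃ splits off
-- J^j, and replacing both centre edges by v₃–v₂ splits off G^g. Iterating moves leg three onto leg one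
-- one vertex at a time, and the split-off terms are the summands. Coefficients of X are counts of proper
-- colourings with a given colour vector, so each graph identity becomes a relabelling of vertices, and a
-- product of two X's counts the colourings of a disjoint union.
module Submission where

open import Defs
open import Data.Bool using (Bool; true; false; _∧_; not; if_then_else_; T)
open import Data.Bool.Properties using (∧-assoc; ∧-comm; ∧-commutativeMonoid)
open import Algebra.Solver.CommutativeMonoid ∧-commutativeMonoid using (solve; _⊜_) renaming (_⊕_ to _⊗_; id to ε)
open import Data.Empty using (⊥-elim)
import Data.Integer as ℤ
import Data.Integer.Properties as ℤ
open import Data.Fin using (Fin; zero; suc; toℕ; fromℕ<)
open import Data.Fin.Properties using (toℕ<n; toℕ-fromℕ<; fromℕ<-cong; toℕ-injective) renaming (_≟_ to _≟ᶠ_)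
open import Data.List using (List; []; _∷_; _++_; map; concatMap; upTo; applyUpTo; tabulate; allFin)
open import Data.List.Properties using (map-tabulate; map-cong)
open import Data.Nat using (ℕ; zero; suc; _+_; _*_; _∸_; _≤_; _<_; z≤n; s≤s; z<s; s<s; s≤s⁻¹; _≡ᵇ_; _<ᵇ_)
open import Data.Nat.Properties
open import Data.Nat.Tactic.RingSolver using (solve-∀)
open import Data.Integer.Tactic.RingSolver using () renaming (solve-∀ to solve-∀ℤ)
open import Algebra.Properties.CommutativeSemigroup +-commutativeSemigroup using () renaming (interchange to +-interchange)
open import Algebra.Properties.CommutativeSemigroup *-commutativeSemigroup using () renaming (interchange to *-interchange)
import Data.List.Relation.Unary.All as All
open import Data.List.Relation.Unary.All using (All; []; _∷_)
open import Data.List.Relation.Unary.All.Properties using (++⁺; map⁺; applyUpTo⁺₁)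
open import Data.Maybe using (Maybe; just; nothing)
open import Data.Product using (_×_; _,_; proj₁; proj₂; ∃-syntax)
import Data.Vec as V
open import Data.Vec using (Vec; []; _∷_; lookup; zipWith)
open import Data.Vec.Properties using (≡-dec; lookup∘tabulate; tabulate∘lookup; tabulate-cong)
open import Function using (_∘_; id; _⇔_; mk⇔)
open import Relation.Binary.Definitions using (DecidableEquality)
open import Relation.Binary.PropositionalEquality
open import Relation.Nullary using (yes; no; contradiction)
open import Relation.Nullary.Decidable using (⌊_⌋; does; does-⇔; dec-true; dec-false; isYes≗does)

𝟙 : Bool → ℕ
𝟙 true  = 1
𝟙 false = 0

𝟙-∧ : ∀ a b → 𝟙 (a ∧ b) ≡ 𝟙 a * 𝟙 b
𝟙-∧ true  b = sym (*-identityˡ (𝟙 b))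
𝟙-∧ false b = refl

𝟙-positive : ∀ {b} → 0 < 𝟙 b → T b
𝟙-positive {true} _ = _

𝟙-mono : ∀ {a b} → (T a → T b) → 𝟙 a ≤ 𝟙 b
𝟙-mono {false}         _ = z≤n
𝟙-mono {true} {true}  _ = ≤-refl
𝟙-mono {true} {false} f = ⊥-elim (f _)

𝟙-∧-interchange : ∀ a b c d → 𝟙 (a ∧ b) * 𝟙 (c ∧ d) ≡ (𝟙 a * 𝟙 c) * (𝟙 b * 𝟙 d)
𝟙-∧-interchange a b c d = trans (cong₂ _*_ (𝟙-∧ a b) (𝟙-∧ c d)) (*-interchange (𝟙 a) (𝟙 b) (𝟙 c) (𝟙 d))

private variable A B C : Set

∑ : List A → (A → ℕ) → ℕ
∑ []       f = 0
∑ (x ∷ xs) f = f x + ∑ xs f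

syntax ∑ L (λ x → e) = ∑[ x ∈ L ] e

∑-cong : (L : List A) {f g : A → ℕ} → (∀ x → f x ≡ g x) → ∑ L f ≡ ∑ L g
∑-cong []      e = refl
∑-cong (x ∷ L) e = cong₂ _+_ (e x) (∑-cong L e)

∑-++ : (L M : List A) (f : A → ℕ) → ∑ (L ++ M) f ≡ ∑ L f + ∑ M f
∑-++ []      M f = refl
∑-++ (x ∷ L) M f = trans (cong (f x +_) (∑-++ L M f)) (sym (+-assoc (f x) _ _))

∑-map : (h : A → B) (L : List A) (f : B → ℕ) → ∑ (map h L) f ≡ ∑ L (f ∘ h)
∑-map h []      f = refl
∑-map h (x ∷ L) f = cong (f (h x) +_) (∑-map h L f)

∑-concatMap : (h : A → List B) (L : List A) (f : B → ℕ) →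
              ∑ (concatMap h L) f ≡ ∑[ x ∈ L ] ∑ (h x) f
∑-concatMap h []      f = refl
∑-concatMap h (x ∷ L) f =
  trans (∑-++ (h x) (concatMap h L) f) (cong (∑ (h x) f +_) (∑-concatMap h L f))

∑-zero : (L : List A) → ∑[ x ∈ L ] 0 ≡ 0
∑-zero []      = refl
∑-zero (x ∷ L) = ∑-zero L

∑-+ : (L : List A) (f g : A → ℕ) → ∑[ x ∈ L ] (f x + g x) ≡ ∑ L f + ∑ L g
∑-+ []      f g = refl
∑-+ (x ∷ L) f g =
  trans (cong (f x + g x +_) (∑-+ L f g)) (+-interchange (f x) (g x) (∑ L f) (∑ L g))

∑-*ˡ : (L : List A) (c : ℕ) (f : A → ℕ) → ∑[ x ∈ L ] (c * f x) ≡ c * ∑ L f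
∑-*ˡ []      c f = sym (*-zeroʳ c)
∑-*ˡ (x ∷ L) c f = trans (cong (c * f x +_) (∑-*ˡ L c f)) (sym (*-distribˡ-+ c (f x) _))

∑-*ʳ : (L : List A) (c : ℕ) (f : A → ℕ) → ∑[ x ∈ L ] (f x * c) ≡ ∑ L f * c
∑-*ʳ L c f = trans (∑-cong L (λ x → *-comm (f x) c)) (trans (∑-*ˡ L c f) (*-comm c _))

∑-comm : (L : List A) (M : List B) (f : A → B → ℕ) →
         ∑[ x ∈ L ] ∑[ y ∈ M ] f x y ≡ ∑[ y ∈ M ] ∑[ x ∈ L ] f x y
∑-comm []      M f = sym (∑-zero M)
∑-comm (x ∷ L) M f =
  trans (cong (∑ M (f x) +_) (∑-comm L M f)) (sym (∑-+ M (f x) (λ y → ∑[ x′ ∈ L ] f x′ y)))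

∑< : ℕ → (ℕ → ℕ) → ℕ
∑< zero    f = 0
∑< (suc n) f = f 0 + ∑< n (f ∘ suc)

syntax ∑< n (λ i → e) = ∑[ i < n ] e

∑<-cong : (n : ℕ) {f g : ℕ → ℕ} → (∀ i → i < n → f i ≡ g i) → ∑< n f ≡ ∑< n g
∑<-cong zero    e = refl
∑<-cong (suc n) e = cong₂ _+_ (e 0 z<s) (∑<-cong n (λ i p → e (suc i) (s<s p)))

∑<-mono : (n : ℕ) {f g : ℕ → ℕ} → (∀ i → i < n → f i ≤ g i) → ∑< n f ≤ ∑< n g
∑<-mono zero    e = z≤n
∑<-mono (suc n) e = +-mono-≤ (e 0 z<s) (∑<-mono n (λ i p → e (suc i) (s<s p)))

∑<-const : (n c : ℕ) → ∑[ i < n ] c ≡ n * c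
∑<-const zero    c = refl
∑<-const (suc n) c = cong (c +_) (∑<-const n c)

∑<-+ : (n : ℕ) (f g : ℕ → ℕ) → ∑[ i < n ] (f i + g i) ≡ ∑< n f + ∑< n g
∑<-+ zero    f g = refl
∑<-+ (suc n) f g =
  trans (cong (f 0 + g 0 +_) (∑<-+ n (f ∘ suc) (g ∘ suc)))
        (+-interchange (f 0) (g 0) (∑< n (f ∘ suc)) (∑< n (g ∘ suc)))

∑<-*ʳ : (n c : ℕ) (f : ℕ → ℕ) → ∑[ i < n ] (f i * c) ≡ ∑< n f * c
∑<-*ʳ zero    c f = refl
∑<-*ʳ (suc n) c f = trans (cong (f 0 * c +_) (∑<-*ʳ n c (f ∘ suc))) (sym (*-distribʳ-+ c (f 0) _))

∑<-comm : (n m : ℕ) (f : ℕ → ℕ → ℕ) → ∑[ i < n ] ∑[ j < m ] f i j ≡ ∑[ j < m ] ∑[ i < n ] f i j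
∑<-comm zero    m f = sym (trans (∑<-const m 0) (*-zeroʳ m))
∑<-comm (suc n) m f =
  trans (cong (∑< m (f 0) +_) (∑<-comm n m (f ∘ suc))) (sym (∑<-+ m (f 0) (λ j → ∑[ i < n ] f (suc i) j)))

∑-upTo : (n : ℕ) (f : ℕ → ℕ) → ∑ (upTo n) f ≡ ∑< n f
∑-upTo n f = go id n
  where
  go : (g : ℕ → ℕ) (n : ℕ) → ∑ (applyUpTo g n) f ≡ ∑< n (f ∘ g)
  go g zero    = refl
  go g (suc n) = cong (f (g 0) +_) (go (g ∘ suc) n)

∑-tabulate : ∀ {n} (g : Fin n → A) (f : A → ℕ) → ∑ (tabulate g) f ≡ ∑ (allFin n) (f ∘ g)
∑-tabulate g f = trans (cong (λ L → ∑ L f) (sym (map-tabulate id g))) (∑-map g (allFin _) f)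

if-true : ∀ {b} {u v : A} → b ≡ true → (if b then u else v) ≡ u
if-true refl = refl

if-false : ∀ {b} {u v : A} → b ≡ false → (if b then u else v) ≡ v
if-false refl = refl

<ᵇ-true : ∀ {x a} → x < a → (x <ᵇ a) ≡ true
<ᵇ-true {x} {a} x<a = dec-true (x <? a) x<a

<ᵇ-false : ∀ {x a} → a ≤ x → (x <ᵇ a) ≡ false
<ᵇ-false {x} {a} a≤x = dec-false (x <? a) (≤⇒≯ a≤x)

≡ᵇ-true : ∀ {x y} → x ≡ y → (x ≡ᵇ y) ≡ true
≡ᵇ-true {x} {y} x≡y = dec-true (x ≟ y) x≡y

≡ᵇ-false : ∀ {x y} → x ≢ y → (x ≡ᵇ y) ≡ false
≡ᵇ-false {x} {y} x≢y = dec-false (x ≟ y) x≢y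

δ : ℕ → ℕ → ℕ
δ x y = 𝟙 (does (x ≟ y))

δ-mono : ∀ {x y u v} → (x ≡ y → u ≡ v) → δ x y ≤ δ u v
δ-mono {x} {y} {u} {v} f = 𝟙-mono (λ t → ≡⇒≡ᵇ u v (f (≡ᵇ⇒≡ x y t)))

δ-positive : ∀ {x y} → 0 < δ x y → x ≡ y
δ-positive {x} {y} p = ≡ᵇ⇒≡ x y (𝟙-positive p)

δ-⇔ : ∀ {x y u v} → (x ≡ y ⇔ u ≡ v) → δ x y ≡ δ u v
δ-⇔ {x} {y} {u} {v} e = cong 𝟙 (does-⇔ e (x ≟ y) (u ≟ v))

δ-≢ : ∀ {x y} → x ≢ y → δ x y ≡ 0
δ-≢ {x} {y} x≢y = cong 𝟙 (dec-false (x ≟ y) x≢y)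

∑<-δ : ∀ n z (f : ℕ → ℕ) → z < n → ∑[ y < n ] (δ y z * f y) ≡ f z
∑<-δ (suc n) zero    f _         = trans (cong (f 0 + 0 +_) (trans (∑<-const n 0) (*-zeroʳ n)))
                                          (trans (+-identityʳ _) (+-identityʳ _))
∑<-δ (suc n) (suc z) f (s≤s z<n) = ∑<-δ n z (f ∘ suc) z<n

∑<-δ≤1 : ∀ n z → ∑[ y < n ] δ y z ≤ 1
∑<-δ≤1 zero    z       = z≤n
∑<-δ≤1 (suc n) zero    = s≤s (≤-reflexive (trans (∑<-const n 0) (*-zeroʳ n)))
∑<-δ≤1 (suc n) (suc z) = ∑<-δ≤1 n z

∑<-≤1⇒≤n : ∀ n (f : ℕ → ℕ) → (∀ i → i < n → f i ≤ 1) → ∑< n f ≤ n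
∑<-≤1⇒≤n n f f≤1 = ≤-trans (∑<-mono n f≤1) (≤-reflexive (trans (∑<-const n 1) (*-identityʳ n)))

∑<-≡n⇒≡1 : ∀ n (f : ℕ → ℕ) → (∀ i → i < n → f i ≤ 1) → ∑< n f ≡ n → ∀ i → i < n → f i ≡ 1
∑<-≡n⇒≡1 (suc n) f f≤1 ∑≡ i i<n = ≤-antisym (f≤1 i i<n) (head-and-tail i i<n)
  where
  tail≤ : ∑< n (f ∘ suc) ≤ n
  tail≤ = ∑<-≤1⇒≤n n (f ∘ suc) (λ i p → f≤1 (suc i) (s<s p))
  f0≡1 : f 0 ≡ 1
  f0≡1 = ≤-antisym (f≤1 0 z<s)
                   (+-cancelʳ-≤ n 1 (f 0) (≤-trans (≤-reflexive (sym ∑≡)) (+-monoʳ-≤ (f 0) tail≤)))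
  head-and-tail : ∀ i → i < suc n → 1 ≤ f i
  head-and-tail zero    _         = ≤-reflexive (sym f0≡1)
  head-and-tail (suc i) (s≤s i<n) =
    ≤-reflexive (sym (∑<-≡n⇒≡1 n (f ∘ suc) (λ i p → f≤1 (suc i) (s<s p))
                       (suc-injective (trans (cong (_+ ∑< n (f ∘ suc)) (sym f0≡1)) ∑≡)) i i<n))

∑<-positive : ∀ n (f : ℕ → ℕ) → 0 < ∑< n f → ∃[ i ] i < n × 0 < f i
∑<-positive (suc n) f p with f 0 in f0
... | suc _ = 0 , z<s , subst (0 <_) (sym f0) z<s
... | zero  with ∑<-positive n (f ∘ suc) p
...   | i , i<n , fi = suc i , s<s i<n , fi

∑<-δ-δ : ∀ u w a → ∑[ b < suc a ] (δ u b * δ w (a ∸ b)) ≡ δ (u + w) a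
∑<-δ-δ u w a with u <? suc a
... | yes u<1+a = begin
  ∑[ b < suc a ] (δ u b * δ w (a ∸ b))
    ≡⟨ ∑<-cong (suc a) (λ b _ → cong (_* δ w (a ∸ b)) (δ-⇔ {u} {b} (mk⇔ sym sym))) ⟩
  ∑[ b < suc a ] (δ b u * δ w (a ∸ b))
    ≡⟨ ∑<-δ (suc a) u (λ b → δ w (a ∸ b)) u<1+a ⟩
  δ w (a ∸ u)
    ≡⟨ δ-⇔ {w} {a ∸ u} (mk⇔ (λ e → trans (cong (u +_) e) (m+[n∸m]≡n u≤a))
                            (λ e → trans (sym (m+n∸m≡n u w)) (cong (_∸ u) e))) ⟩
  δ (u + w) a ∎
  where
  open ≡-Reasoning
  u≤a : u ≤ a
  u≤a = s≤s⁻¹ u<1+a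
... | no u≮1+a =
  trans (∑<-cong (suc a) (λ b b<1+a → cong (_* δ w (a ∸ b)) (δ-≢ {u} {b} (λ { refl → u≮1+a b<1+a }))))
        (trans (∑<-const (suc a) 0) (trans (*-zeroʳ a)
        (sym (δ-≢ {u + w} {a} (λ e → u≮1+a (s≤s (subst (u ≤_) e (m≤m+n u w))))))))

∑-allFin-δ : ∀ k (d : Fin k) (f : Fin k → ℕ) → ∑[ c ∈ allFin k ] (𝟙 (does (c ≟ᶠ d)) * f c) ≡ f d
∑-allFin-δ (suc k) zero f =
  trans (cong (f zero + 0 +_) (trans (∑-tabulate {n = k} suc (λ c → 𝟙 (does (c ≟ᶠ zero)) * f c))
                                      (∑-zero (allFin k))))
        (trans (+-identityʳ _) (+-identityʳ _))
∑-allFin-δ (suc k) (suc d) f =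
  trans (∑-tabulate suc (λ c → 𝟙 (does (c ≟ᶠ suc d)) * f c)) (∑-allFin-δ k d (λ c → f (suc c)))

infix 4 _≟ᵛ_
_≟ᵛ_ : ∀ {k n} → DecidableEquality (Vec (Fin k) n)
_≟ᵛ_ = ≡-dec _≟ᶠ_

allVecs-δ : ∀ k n (w : Vec (Fin k) n) (f : Vec (Fin k) n → ℕ) →
            ∑[ v ∈ allVecs k n ] (𝟙 (does (v ≟ᵛ w)) * f v) ≡ f w
allVecs-δ k zero    []      f = trans (+-identityʳ _) (+-identityʳ (f []))
allVecs-δ k (suc n) (d ∷ w) f = begin
  ∑ (concatMap (λ c → map (c ∷_) (allVecs k n)) (allFin k)) (λ v → 𝟙 (does (v ≟ᵛ d ∷ w)) * f v)
    ≡⟨ ∑-concatMap _ (allFin k) _ ⟩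
  ∑[ c ∈ allFin k ] ∑ (map (c ∷_) (allVecs k n)) (λ v → 𝟙 (does (v ≟ᵛ d ∷ w)) * f v)
    ≡⟨ ∑-cong (allFin k) (λ c → trans (∑-map (c ∷_) (allVecs k n) _) (split c)) ⟩
  ∑[ c ∈ allFin k ] (𝟙 (does (c ≟ᶠ d)) * ∑[ v ∈ allVecs k n ] (𝟙 (does (v ≟ᵛ w)) * f (c ∷ v)))
    ≡⟨ ∑-cong (allFin k) (λ c → cong (𝟙 (does (c ≟ᶠ d)) *_) (allVecs-δ k n w (f ∘ (c ∷_)))) ⟩
  ∑[ c ∈ allFin k ] (𝟙 (does (c ≟ᶠ d)) * f (c ∷ w))
    ≡⟨ ∑-allFin-δ k d (λ c → f (c ∷ w)) ⟩
  f (d ∷ w) ∎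
  where
  open ≡-Reasoning
  split : ∀ c → ∑[ v ∈ allVecs k n ] (𝟙 (does (c ≟ᶠ d) ∧ does (v ≟ᵛ w)) * f (c ∷ v))
              ≡ 𝟙 (does (c ≟ᶠ d)) * ∑[ v ∈ allVecs k n ] (𝟙 (does (v ≟ᵛ w)) * f (c ∷ v))
  split c = trans (∑-cong (allVecs k n) (λ v →
                    trans (cong (_* f (c ∷ v)) (𝟙-∧ (does (c ≟ᶠ d)) _)) (*-assoc (𝟙 (does (c ≟ᶠ d))) _ _)))
                  (∑-*ˡ (allVecs k n) (𝟙 (does (c ≟ᶠ d))) _)

allVecs-reindex : ∀ k n (φ ψ : Vec (Fin k) n → Vec (Fin k) n) →
                  (∀ v → ψ (φ v) ≡ v) → (∀ w → φ (ψ w) ≡ w) → (F : Vec (Fin k) n → ℕ) →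
                  ∑[ v ∈ allVecs k n ] F (φ v) ≡ ∑ (allVecs k n) F
allVecs-reindex k n φ ψ ψφ φψ F = begin
  ∑[ v ∈ L ] F (φ v)                                  ≡⟨ ∑-cong L (λ v → sym (allVecs-δ k n (φ v) F)) ⟩
  ∑[ v ∈ L ] ∑[ w ∈ L ] (𝟙 (does (w ≟ᵛ φ v)) * F w)   ≡⟨ ∑-comm L L _ ⟩
  ∑[ w ∈ L ] ∑[ v ∈ L ] (𝟙 (does (w ≟ᵛ φ v)) * F w)   ≡⟨ ∑-cong L (λ w → ∑-*ʳ L (F w) _) ⟩
  ∑[ w ∈ L ] (∑[ v ∈ L ] 𝟙 (does (w ≟ᵛ φ v)) * F w)   ≡⟨ ∑-cong L (λ w → cong (_* F w) (unique w)) ⟩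
  ∑[ w ∈ L ] (1 * F w)                                ≡⟨ ∑-cong L (λ w → *-identityˡ (F w)) ⟩
  ∑ L F                                               ∎
  where
  open ≡-Reasoning
  L : List (Vec (Fin k) n)
  L = allVecs k n
  unique : ∀ w → ∑[ v ∈ L ] 𝟙 (does (w ≟ᵛ φ v)) ≡ 1
  unique w = trans (∑-cong L (λ v → trans (cong 𝟙 (does-⇔ w≡φv⇔v≡ψw (w ≟ᵛ φ v) (v ≟ᵛ ψ w)))
                                          (sym (*-identityʳ _))))
                   (allVecs-δ k n (ψ w) (λ _ → 1))
    where
    w≡φv⇔v≡ψw : ∀ {v} → w ≡ φ v ⇔ v ≡ ψ w
    w≡φv⇔v≡ψw {v} = mk⇔ (λ e → trans (sym (ψφ v)) (cong ψ (sym e)))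
                        (λ e → trans (sym (φψ w)) (cong φ (sym e)))

allVecs-++ : ∀ k n m (F : Vec (Fin k) (n + m) → ℕ) →
             ∑ (allVecs k (n + m)) F ≡ ∑[ u ∈ allVecs k n ] ∑[ v ∈ allVecs k m ] F (u V.++ v)
allVecs-++ k zero    m F = sym (+-identityʳ _)
allVecs-++ k (suc n) m F = begin
  ∑ (allVecs k (suc n + m)) F
    ≡⟨ ∑-concatMap _ (allFin k) F ⟩
  ∑[ c ∈ allFin k ] ∑ (map (c ∷_) (allVecs k (n + m))) F
    ≡⟨ ∑-cong (allFin k) (λ c → trans (∑-map (c ∷_) (allVecs k (n + m)) F) (allVecs-++ k n m (F ∘ (c ∷_)))) ⟩
  ∑[ c ∈ allFin k ] ∑[ u ∈ allVecs k n ] ∑[ v ∈ allVecs k m ] F (c ∷ u V.++ v)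
    ≡⟨ ∑-cong (allFin k) (λ c → sym (∑-map (c ∷_) (allVecs k n) _)) ⟩
  ∑[ c ∈ allFin k ] ∑ (map (c ∷_) (allVecs k n)) (λ u → ∑[ v ∈ allVecs k m ] F (u V.++ v))
    ≡⟨ sym (∑-concatMap _ (allFin k) _) ⟩
  ∑[ u ∈ allVecs k (suc n) ] ∑[ v ∈ allVecs k m ] F (u V.++ v) ∎
  where open ≡-Reasoning

infixl 6 _+ᵛ_ _∸ᵛ_
_+ᵛ_ _∸ᵛ_ : ∀ {k} → Vec ℕ k → Vec ℕ k → Vec ℕ k
_+ᵛ_ = zipWith _+_
_∸ᵛ_ = zipWith _∸_

∑-below-δ : ∀ k (v w α : Vec ℕ k) →
            ∑[ β ∈ below α ] (𝟙 (eqVecᵇ v β) * 𝟙 (eqVecᵇ w (α ∸ᵛ β)))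
            ≡ 𝟙 (eqVecᵇ (v +ᵛ w) α)
∑-below-δ zero    []       []       []      = refl
∑-below-δ (suc k) (u ∷ v) (w ∷ w′) (a ∷ α) = begin
  ∑ (concatMap (λ b → map (b ∷_) (below α)) (upTo (suc a))) F
    ≡⟨ ∑-concatMap (λ b → map (b ∷_) (below α)) (upTo (suc a)) F ⟩
  ∑[ b ∈ upTo (suc a) ] ∑ (map (b ∷_) (below α)) F
    ≡⟨ ∑-cong (upTo (suc a)) (λ b → trans (∑-map (b ∷_) (below α) F) (split b)) ⟩
  ∑[ b ∈ upTo (suc a) ] (δ u b * δ w (a ∸ b) * 𝟙 (eqVecᵇ (v +ᵛ w′) α))
    ≡⟨ ∑-*ʳ (upTo (suc a)) _ (λ b → δ u b * δ w (a ∸ b)) ⟩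
  ∑[ b ∈ upTo (suc a) ] (δ u b * δ w (a ∸ b)) * 𝟙 (eqVecᵇ (v +ᵛ w′) α)
    ≡⟨ cong (_* 𝟙 (eqVecᵇ (v +ᵛ w′) α))
            (trans (∑-upTo (suc a) (λ b → δ u b * δ w (a ∸ b))) (∑<-δ-δ u w a)) ⟩
  δ (u + w) a * 𝟙 (eqVecᵇ (v +ᵛ w′) α)
    ≡⟨ sym (𝟙-∧ ((u + w) ≡ᵇ a) _) ⟩
  𝟙 (eqVecᵇ ((u ∷ v) +ᵛ (w ∷ w′)) (a ∷ α))
    ∎
  where
  open ≡-Reasoning
  F : Vec ℕ (suc k) → ℕ
  F β = 𝟙 (eqVecᵇ (u ∷ v) β) * 𝟙 (eqVecᵇ (w ∷ w′) ((a ∷ α) ∸ᵛ β))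
  split : ∀ b → ∑[ β ∈ below α ] F (b ∷ β) ≡ δ u b * δ w (a ∸ b) * 𝟙 (eqVecᵇ (v +ᵛ w′) α)
  split b = begin
    ∑[ β ∈ below α ] F (b ∷ β)
      ≡⟨ ∑-cong (below α) (λ β → 𝟙-∧-interchange (u ≡ᵇ b) _ (w ≡ᵇ (a ∸ b)) _) ⟩
    ∑[ β ∈ below α ] (δ u b * δ w (a ∸ b) * (𝟙 (eqVecᵇ v β) * 𝟙 (eqVecᵇ w′ (α ∸ᵛ β))))
      ≡⟨ ∑-*ˡ (below α) (δ u b * δ w (a ∸ b)) _ ⟩
    δ u b * δ w (a ∸ b) * ∑[ β ∈ below α ] (𝟙 (eqVecᵇ v β) * 𝟙 (eqVecᵇ w′ (α ∸ᵛ β)))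
      ≡⟨ cong (δ u b * δ w (a ∸ b) *_) (∑-below-δ k v w′ α) ⟩
    δ u b * δ w (a ∸ b) * 𝟙 (eqVecᵇ (v +ᵛ w′) α) ∎

Colouring : ℕ → Set
Colouring k = ℕ → Maybe (Fin k)

differ : ∀ {k} → Colouring k → ℕ → ℕ → Bool
differ c x y = not (sameColor (c x) (c y))

proper : ∀ {k} → Colouring k → List (ℕ × ℕ) → Bool
proper c []            = true
proper c ((x , y) ∷ E) = differ c x y ∧ proper c E

module _ {k : ℕ} where

  properᵇ≡proper : ∀ {n} (E : List (ℕ × ℕ)) (κ : Vec (Fin k) n) → properᵇ E κ ≡ proper (at κ) E
  properᵇ≡proper []            κ = refl
  properᵇ≡proper ((x , y) ∷ E) κ = cong (differ (at κ) x y ∧_) (properᵇ≡proper E κ)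

  proper-cong : {c c′ : Colouring k} (E : List (ℕ × ℕ)) → (∀ x → c x ≡ c′ x) → proper c E ≡ proper c′ E
  proper-cong []            e = refl
  proper-cong ((x , y) ∷ E) e = cong₂ _∧_ (cong₂ (λ a b → not (sameColor a b)) (e x) (e y)) (proper-cong E e)

  proper-cong-on : {c c′ : Colouring k} (E : List (ℕ × ℕ)) →
                   All (λ e → c (proj₁ e) ≡ c′ (proj₁ e) × c (proj₂ e) ≡ c′ (proj₂ e)) E →
                   proper c E ≡ proper c′ E
  proper-cong-on []            []                = refl
  proper-cong-on ((x , y) ∷ E) ((ex , ey) ∷ es) =
    cong₂ _∧_ (cong₂ (λ a b → not (sameColor a b)) ex ey) (proper-cong-on E es)

  proper-++ : (c : Colouring k) (E F : List (ℕ × ℕ)) → proper c (E ++ F) ≡ proper c E ∧ proper c F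
  proper-++ c []            F = refl
  proper-++ c ((x , y) ∷ E) F = trans (cong (differ c x y ∧_) (proper-++ c E F)) (sym (∧-assoc (differ c x y) _ _))

  proper-map : (c : Colouring k) (f : ℕ → ℕ) (E : List (ℕ × ℕ)) →
               proper c (map (λ e → f (proj₁ e) , f (proj₂ e)) E) ≡ proper (c ∘ f) E
  proper-map c f []            = refl
  proper-map c f ((x , y) ∷ E) = cong (differ c (f x) (f y) ∧_) (proper-map c f E)

counted : ∀ {k n} → (∀ {k} → Colouring k → Bool) → Vec ℕ k → Vec (Fin k) n → ℕ
counted Q α κ = 𝟙 (Q (at κ) ∧ eqVecᵇ (colorCounts κ) α)

#colourings : ℕ → (∀ {k} → Colouring k → Bool) → (k : ℕ) → Vec ℕ k → ℕ
#colourings n Q k α = ∑ (allVecs k n) (counted Q α)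

#colourings-cong : ∀ n {Q Q′ : ∀ {k} → Colouring k → Bool} → (∀ {k} (c : Colouring k) → Q c ≡ Q′ c) →
                   ∀ k α → #colourings n Q k α ≡ #colourings n Q′ k α
#colourings-cong n e k α = ∑-cong (allVecs k n) (λ κ → cong (λ b → 𝟙 (b ∧ _)) (e (at κ)))

∑≡countᵇ : (p : A → Bool) (L : List A) → ∑[ x ∈ L ] 𝟙 (p x) ≡ countᵇ p L
∑≡countᵇ p []      = refl
∑≡countᵇ p (x ∷ L) with p x
... | true  = cong suc (∑≡countᵇ p L)
... | false = ∑≡countᵇ p L

X≡#colourings : ∀ G k α → X G k α ≡ ℤ.+ #colourings (n G) (λ c → proper c (edges G)) k α
X≡#colourings G k α = cong ℤ.+_ (sym (trans (∑-cong (allVecs k (n G)) properᵇ≡)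
                                          (∑≡countᵇ _ (allVecs k (n G)))))
  where
  properᵇ≡ : ∀ κ → counted (λ c → proper c (edges G)) α κ
                 ≡ 𝟙 (properᵇ (edges G) κ ∧ eqVecᵇ (colorCounts κ) α)
  properᵇ≡ κ = cong (λ b → 𝟙 (b ∧ eqVecᵇ (colorCounts κ) α)) (sym (properᵇ≡proper (edges G) κ))

at-lookup : ∀ {n} (v : Vec A n) x (x<n : x < n) → at v x ≡ just (lookup v (fromℕ< x<n))
at-lookup (a ∷ v) zero    _         = refl
at-lookup (a ∷ v) (suc x) (s≤s x<n) = at-lookup v x x<n

at-≥ : ∀ {n} (v : Vec A n) x → n ≤ x → at v x ≡ nothing
at-≥ []      x       _         = refl
at-≥ (a ∷ v) (suc x) (s≤s n≤x) = at-≥ v x n≤x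

at-++ˡ : ∀ {n m} (u : Vec A n) (v : Vec A m) x → x < n → at (u V.++ v) x ≡ at u x
at-++ˡ (a ∷ u) v zero    _         = refl
at-++ˡ (a ∷ u) v (suc x) (s≤s x<n) = at-++ˡ u v x x<n

at-++ʳ : ∀ {n m} (u : Vec A n) (v : Vec A m) x → at (u V.++ v) (n + x) ≡ at v x
at-++ʳ []      v x = refl
at-++ʳ (a ∷ u) v x = at-++ʳ u v x

hasColour : ∀ {k} → Fin k → Maybe (Fin k) → ℕ
hasColour c (just d) = if ⌊ c ≟ᶠ d ⌋ then 1 else 0
hasColour c nothing  = 0

countColor≡∑ : ∀ {k n} (c : Fin k) (v : Vec (Fin k) n) → countColor c v ≡ ∑[ x < n ] hasColour c (at v x)
countColor≡∑ c []      = refl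
countColor≡∑ c (d ∷ v) = cong (hasColour c (just d) +_) (countColor≡∑ c v)

countColor-++ : ∀ {k n m} (c : Fin k) (u : Vec (Fin k) n) (v : Vec (Fin k) m) →
                countColor c (u V.++ v) ≡ countColor c u + countColor c v
countColor-++ c []      v = refl
countColor-++ c (d ∷ u) v =
  trans (cong (hasColour c (just d) +_) (countColor-++ c u v)) (sym (+-assoc (hasColour c (just d)) _ _))

zipWith-tabulate : ∀ {k} (_∙_ : A → B → C) (f : Fin k → A) (g : Fin k → B) →
                   zipWith _∙_ (V.tabulate f) (V.tabulate g) ≡ V.tabulate (λ c → f c ∙ g c)
zipWith-tabulate {k = zero}  _∙_ f g = refl
zipWith-tabulate {k = suc k} _∙_ f g = cong (f zero ∙ g zero ∷_) (zipWith-tabulate _∙_ (f ∘ suc) (g ∘ suc))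

colorCounts-++ : ∀ {k n m} (u : Vec (Fin k) n) (v : Vec (Fin k) m) →
                 colorCounts (u V.++ v) ≡ colorCounts u +ᵛ colorCounts v
colorCounts-++ u v = trans (tabulate-cong (λ c → countColor-++ c u v)) (sym (zipWith-tabulate _+_ _ _))

-- Relabelling vertices

-- to-≥ is needed because colourings are read on all of ℕ, uncoloured beyond n.
record Relabelling (n : ℕ) : Set where
  field
    to from : ℕ → ℕ
    to-<    : ∀ x → x < n → to x < n
    to-≥    : ∀ x → n ≤ x → n ≤ to x
    from-to : ∀ x → x < n → from (to x) ≡ x

-- An injective self-map of {0,…,n-1} is onto: each y has at most one preimage and they total n.
module _ {n : ℕ} (ρ : Relabelling n) where
  open Relabelling ρ

  private
    preimages : ℕ → ℕ
    preimages y = ∑[ x < n ] δ y (to x)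

    δ-to≤δ-from : ∀ x y → x < n → δ y (to x) ≤ δ x (from y)
    δ-to≤δ-from x y x<n = δ-mono (λ y≡to-x → sym (trans (cong from y≡to-x) (from-to x x<n)))

    preimages≡1 : ∀ y → y < n → preimages y ≡ 1
    preimages≡1 = ∑<-≡n⇒≡1 n preimages at-most-one total
      where
      at-most-one : ∀ y → y < n → preimages y ≤ 1
      at-most-one y _ = ≤-trans (∑<-mono n (λ x x<n → δ-to≤δ-from x y x<n)) (∑<-δ≤1 n (from y))
      total : ∑< n preimages ≡ n
      total = begin
        ∑[ y < n ] ∑[ x < n ] δ y (to x)
          ≡⟨ ∑<-comm n n (λ y x → δ y (to x)) ⟩
        ∑[ x < n ] ∑[ y < n ] δ y (to x)
          ≡⟨ ∑<-cong n (λ x _ → ∑<-cong n (λ y _ → sym (*-identityʳ _))) ⟩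
        ∑[ x < n ] ∑[ y < n ] (δ y (to x) * 1)
          ≡⟨ ∑<-cong n (λ x x<n → ∑<-δ n (to x) (λ _ → 1) (to-< x x<n)) ⟩
        ∑[ x < n ] 1
          ≡⟨ trans (∑<-const n 1) (*-identityʳ n) ⟩
        n ∎
        where open ≡-Reasoning

  ∑<-relabel : (f : ℕ → ℕ) → ∑[ x < n ] f (to x) ≡ ∑< n f
  ∑<-relabel f = begin
    ∑[ x < n ] f (to x)
      ≡⟨ ∑<-cong n (λ x x<n → sym (∑<-δ n (to x) f (to-< x x<n))) ⟩
    ∑[ x < n ] ∑[ y < n ] (δ y (to x) * f y)
      ≡⟨ ∑<-comm n n _ ⟩
    ∑[ y < n ] ∑[ x < n ] (δ y (to x) * f y)
      ≡⟨ ∑<-cong n (λ y _ → ∑<-*ʳ n (f y) (λ x → δ y (to x))) ⟩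
    ∑[ y < n ] (preimages y * f y)
      ≡⟨ ∑<-cong n (λ y y<n → trans (cong (_* f y) (preimages≡1 y y<n)) (*-identityˡ (f y))) ⟩
    ∑< n f ∎
    where open ≡-Reasoning

  preimage : ∀ y → y < n → ∃[ x ] x < n × to x ≡ y
  preimage y y<n with ∑<-positive n (λ x → δ y (to x)) (≤-reflexive (sym (preimages≡1 y y<n)))
  ... | x , x<n , hit = x , x<n , sym (δ-positive hit)

  from-< : ∀ y → y < n → from y < n
  from-< y y<n with preimage y y<n
  ... | x , x<n , refl = subst (_< n) (sym (from-to x x<n)) x<n

  to-from : ∀ y → y < n → to (from y) ≡ y
  to-from y y<n with preimage y y<n
  ... | x , x<n , refl = cong to (from-to x x<n)

  private
    toᶠ fromᶠ : Fin n → Fin n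
    toᶠ   i = fromℕ< (to-< (toℕ i) (toℕ<n i))
    fromᶠ i = fromℕ< (from-< (toℕ i) (toℕ<n i))

    toℕ-toᶠ : ∀ i → toℕ (toᶠ i) ≡ to (toℕ i)
    toℕ-toᶠ i = toℕ-fromℕ< _

    toℕ-fromᶠ : ∀ i → toℕ (fromᶠ i) ≡ from (toℕ i)
    toℕ-fromᶠ i = toℕ-fromℕ< _

    toᶠ-fromᶠ : ∀ i → toᶠ (fromᶠ i) ≡ i
    toᶠ-fromᶠ i = toℕ-injective (trans (toℕ-toᶠ (fromᶠ i))
                                   (trans (cong to (toℕ-fromᶠ i)) (to-from (toℕ i) (toℕ<n i))))

    fromᶠ-toᶠ : ∀ i → fromᶠ (toᶠ i) ≡ i
    fromᶠ-toᶠ i = toℕ-injective (trans (toℕ-fromᶠ (toᶠ i))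
                                   (trans (cong from (toℕ-toᶠ i)) (from-to (toℕ i) (toℕ<n i))))

    vec-ext : ∀ {k} (v w : Vec (Fin k) n) → (∀ i → lookup v i ≡ lookup w i) → v ≡ w
    vec-ext v w e = trans (sym (tabulate∘lookup v)) (trans (tabulate-cong e) (tabulate∘lookup w))

  relabel unrelabel : ∀ {k} → Vec (Fin k) n → Vec (Fin k) n
  relabel   κ = V.tabulate (lookup κ ∘ toᶠ)
  unrelabel κ = V.tabulate (lookup κ ∘ fromᶠ)

  unrelabel-relabel : ∀ {k} (κ : Vec (Fin k) n) → unrelabel (relabel κ) ≡ κ
  unrelabel-relabel κ = vec-ext _ _ (λ i →
    trans (lookup∘tabulate _ i) (trans (lookup∘tabulate _ (fromᶠ i)) (cong (lookup κ) (toᶠ-fromᶠ i))))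

  relabel-unrelabel : ∀ {k} (κ : Vec (Fin k) n) → relabel (unrelabel κ) ≡ κ
  relabel-unrelabel κ = vec-ext _ _ (λ i →
    trans (lookup∘tabulate _ i) (trans (lookup∘tabulate _ (toᶠ i)) (cong (lookup κ) (fromᶠ-toᶠ i))))

  at-relabel : ∀ {k} (κ : Vec (Fin k) n) x → at (relabel κ) x ≡ at κ (to x)
  at-relabel κ x with x <? n
  ... | yes x<n = begin
    at (relabel κ) x
      ≡⟨ at-lookup (relabel κ) x x<n ⟩
    just (lookup (relabel κ) (fromℕ< x<n))
      ≡⟨ cong just (lookup∘tabulate _ (fromℕ< x<n)) ⟩
    just (lookup κ (toᶠ (fromℕ< x<n)))
      ≡⟨ cong (just ∘ lookup κ) (fromℕ<-cong _ _ (cong to (toℕ-fromℕ< x<n)) _ _) ⟩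
    just (lookup κ (fromℕ< (to-< x x<n)))
      ≡⟨ sym (at-lookup κ (to x) (to-< x x<n)) ⟩
    at κ (to x) ∎
    where open ≡-Reasoning
  ... | no x≮n = trans (at-≥ (relabel κ) x (≮⇒≥ x≮n)) (sym (at-≥ κ (to x) (to-≥ x (≮⇒≥ x≮n))))

  colorCounts-relabel : ∀ {k} (κ : Vec (Fin k) n) → colorCounts (relabel κ) ≡ colorCounts κ
  colorCounts-relabel κ = tabulate-cong (λ c → begin
    countColor c (relabel κ)                    ≡⟨ countColor≡∑ c (relabel κ) ⟩
    ∑[ x < n ] hasColour c (at (relabel κ) x)   ≡⟨ ∑<-cong n (λ x _ → cong (hasColour c) (at-relabel κ x)) ⟩
    ∑[ x < n ] hasColour c (at κ (to x))        ≡⟨ ∑<-relabel (hasColour c ∘ at κ) ⟩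
    ∑[ x < n ] hasColour c (at κ x)             ≡⟨ sym (countColor≡∑ c κ) ⟩
    countColor c κ                              ∎)
    where open ≡-Reasoning

  #colourings-relabel : (Q Q′ : ∀ {k} → Colouring k → Bool) →
                        (∀ {k} {c c′ : Colouring k} → (∀ x → c x ≡ c′ x) → Q c ≡ Q c′) →
                        (∀ {k} (c : Colouring k) → Q (c ∘ to) ≡ Q′ c) →
                        ∀ k α → #colourings n Q′ k α ≡ #colourings n Q k α
  #colourings-relabel Q Q′ Q-ext Q∘to k α =
    trans (∑-cong (allVecs k n) (λ κ → cong 𝟙 (cong₂ _∧_
            (trans (sym (Q∘to (at κ))) (Q-ext (λ x → sym (at-relabel κ x))))
            (cong (λ v → eqVecᵇ v α) (sym (colorCounts-relabel κ))))))
          (allVecs-reindex k n relabel unrelabel unrelabel-relabel relabel-unrelabel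
            (counted Q α))

#colourings-relabel-graph : ∀ G {m} → n G ≡ m → (ρ : Relabelling m) {Q : ∀ {k} → Colouring k → Bool} →
                            (∀ {k} (c : Colouring k) → proper (c ∘ Relabelling.to ρ) (edges G) ≡ Q c) →
                            ∀ k α → #colourings (n G) (λ c → proper c (edges G)) k α ≡ #colourings m Q k α
#colourings-relabel-graph G refl ρ {Q} relabelled k α =
  sym (#colourings-relabel ρ (λ c → proper c (edges G)) Q (proper-cong (edges G)) relabelled k α)

rotate : ℕ → ℕ → ℕ
rotate m zero    = m
rotate m (suc x) = if x <ᵇ m then x else suc x

rotate-below : ∀ m x → x < m → rotate m (suc x) ≡ x
rotate-below m x x<m = if-true (<ᵇ-true x<m)

rotate-above : ∀ m x → m ≤ x → rotate m (suc x) ≡ suc x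
rotate-above m x m≤x = if-false (<ᵇ-false m≤x)

unrotate : ℕ → ℕ → ℕ
unrotate m y = if y <ᵇ m then suc y else (if y ≡ᵇ m then 0 else y)

rotation : ∀ m n → m < n → Relabelling n
rotation m n m<n = record
  { to      = rotate m
  ; from    = unrotate m
  ; to-<    = to-<
  ; to-≥    = to-≥
  ; from-to = from-to
  }
  where
  to-< : ∀ x → x < n → rotate m x < n
  to-< zero    _      = m<n
  to-< (suc x) 1+x<n with x <? m
  ... | yes x<m = subst (_< n) (sym (rotate-below m x x<m)) (<-trans (n<1+n x) 1+x<n)
  ... | no  x≮m = subst (_< n) (sym (rotate-above m x (≮⇒≥ x≮m))) 1+x<n
  to-≥ : ∀ x → n ≤ x → n ≤ rotate m x
  to-≥ zero    n≤0   = contradiction (<-≤-trans m<n n≤0) (λ ())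
  to-≥ (suc x) n≤1+x = subst (n ≤_) (sym (rotate-above m x (≤-pred (≤-trans m<n n≤1+x)))) n≤1+x
  from-to : ∀ x → x < n → unrotate m (rotate m x) ≡ x
  from-to zero    _ = trans (if-false (<ᵇ-false {m} ≤-refl)) (if-true (≡ᵇ-true {m} refl))
  from-to (suc x) _ with x <? m
  ... | yes x<m = trans (cong (unrotate m) (rotate-below m x x<m)) (if-true (<ᵇ-true x<m))
  ... | no  x≮m = trans (cong (unrotate m) (rotate-above m x m≤x))
                        (trans (if-false (<ᵇ-false (≤-trans m≤x (n≤1+n x))))
                               (if-false (≡ᵇ-false (λ e → x≮m (subst (x <_) e ≤-refl)))))
    where
    m≤x : m ≤ x
    m≤x = ≮⇒≥ x≮m

-- Disjoint unions

shiftEdges : ℕ → List (ℕ × ℕ) → List (ℕ × ℕ)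
shiftEdges m = map (λ e → m + proj₁ e , m + proj₂ e)

infixr 5 _⊎ᴳ_
_⊎ᴳ_ : Graph → Graph → Graph
A ⊎ᴳ B = mkGraph (n A + n B) (edges A ++ shiftEdges (n A) (edges B))

EdgesWithin : ℕ → List (ℕ × ℕ) → Set
EdgesWithin m = All (λ e → proj₁ e < m × proj₂ e < m)

sumℤ-+ : (L : List A) (f : A → ℕ) → sumℤ (map (λ x → ℤ.+ f x) L) ≡ ℤ.+ ∑ L f
sumℤ-+ []      f = refl
sumℤ-+ (x ∷ L) f = trans (cong (ℤ._+_ (ℤ.+ f x)) (sumℤ-+ L f)) (sym (ℤ.pos-+ (f x) _))

-- A pair of colourings with colour vectors β and α − β is one colouring of A ⊎ᴳ B with colour vector α.
X-⊛ : ∀ A B → EdgesWithin (n A) (edges A) → ∀ k α →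
      (X A ⊛ X B) k α ≡ ℤ.+ #colourings (n A + n B) (λ c → proper c (edges (A ⊎ᴳ B))) k α
X-⊛ A B A-within k α = begin
  sumℤ (map (λ β → X A k β ℤ.* X B k (α ∸ᵛ β)) (below α))
    ≡⟨ cong sumℤ (map-cong (λ β → trans (cong₂ ℤ._*_ (X≡#colourings A k β) (X≡#colourings B k (α ∸ᵛ β)))
                                        (sym (ℤ.pos-* (#A β) (#B (α ∸ᵛ β)))))
                           (below α)) ⟩
  sumℤ (map (λ β → ℤ.+ (#A β * #B (α ∸ᵛ β))) (below α))
    ≡⟨ sumℤ-+ (below α) _ ⟩
  ℤ.+ ∑[ β ∈ below α ] (#A β * #B (α ∸ᵛ β))
    ≡⟨ cong ℤ.+_ count-pairs ⟩
  ℤ.+ #colourings (n A + n B) (λ c → proper c (edges (A ⊎ᴳ B))) k α ∎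
  where
  open ≡-Reasoning
  #A #B : Vec ℕ k → ℕ
  #A = #colourings (n A) (λ c → proper c (edges A)) k
  #B = #colourings (n B) (λ c → proper c (edges B)) k
  LA : List (Vec (Fin k) (n A))
  LA = allVecs k (n A)
  LB : List (Vec (Fin k) (n B))
  LB = allVecs k (n B)
  properWith : ∀ {m} → List (ℕ × ℕ) → Vec (Fin k) m → Vec ℕ k → ℕ
  properWith E κ β = counted (λ c → proper c E) β κ

  proper-⊎ : ∀ u v → proper (at (u V.++ v)) (edges (A ⊎ᴳ B)) ≡ proper (at u) (edges A) ∧ proper (at v) (edges B)
  proper-⊎ u v = trans (proper-++ _ (edges A) _) (cong₂ _∧_
    (proper-cong-on (edges A) (All.map (λ (p , q) → at-++ˡ u v _ p , at-++ˡ u v _ q) A-within))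
    (trans (proper-map _ (n A +_) (edges B)) (proper-cong (edges B) (at-++ʳ u v))))

  pair : ∀ u v → ∑[ β ∈ below α ] (properWith (edges A) u β * properWith (edges B) v (α ∸ᵛ β))
               ≡ properWith (edges (A ⊎ᴳ B)) (u V.++ v) α
  pair u v = begin
    ∑[ β ∈ below α ] (properWith (edges A) u β * properWith (edges B) v (α ∸ᵛ β))
      ≡⟨ ∑-cong (below α) (λ β → 𝟙-∧-interchange (proper (at u) (edges A)) _ (proper (at v) (edges B)) _) ⟩
    ∑[ β ∈ below α ] (𝟙 pA * 𝟙 pB * (𝟙 (eqVecᵇ cu β) * 𝟙 (eqVecᵇ cv (α ∸ᵛ β))))
      ≡⟨ ∑-*ˡ (below α) (𝟙 pA * 𝟙 pB) _ ⟩
    𝟙 pA * 𝟙 pB * ∑[ β ∈ below α ] (𝟙 (eqVecᵇ cu β) * 𝟙 (eqVecᵇ cv (α ∸ᵛ β)))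
      ≡⟨ cong (𝟙 pA * 𝟙 pB *_) (∑-below-δ k cu cv α) ⟩
    𝟙 pA * 𝟙 pB * 𝟙 (eqVecᵇ (cu +ᵛ cv) α)
      ≡⟨ cong₂ _*_ (sym (𝟙-∧ pA pB)) (cong (λ z → 𝟙 (eqVecᵇ z α)) (sym (colorCounts-++ u v))) ⟩
    𝟙 (pA ∧ pB) * 𝟙 (eqVecᵇ (colorCounts (u V.++ v)) α)
      ≡⟨ sym (𝟙-∧ (pA ∧ pB) _) ⟩
    𝟙 ((pA ∧ pB) ∧ eqVecᵇ (colorCounts (u V.++ v)) α)
      ≡⟨ cong (λ b → 𝟙 (b ∧ eqVecᵇ (colorCounts (u V.++ v)) α)) (sym (proper-⊎ u v)) ⟩
    properWith (edges (A ⊎ᴳ B)) (u V.++ v) α ∎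
    where
    pA pB : Bool
    pA = proper (at u) (edges A)
    pB = proper (at v) (edges B)
    cu cv : Vec ℕ k
    cu = colorCounts u
    cv = colorCounts v

  count-pairs : ∑[ β ∈ below α ] (#A β * #B (α ∸ᵛ β))
              ≡ #colourings (n A + n B) (λ c → proper c (edges (A ⊎ᴳ B))) k α
  count-pairs = begin
    ∑[ β ∈ below α ] (#A β * #B (α ∸ᵛ β))
      ≡⟨ ∑-cong (below α) (λ β → trans (sym (∑-*ʳ LA _ (λ u → properWith (edges A) u β)))
                                       (∑-cong LA (λ u → sym (∑-*ˡ LB (properWith (edges A) u β) _)))) ⟩
    ∑[ β ∈ below α ] ∑[ u ∈ LA ] ∑[ v ∈ LB ] (properWith (edges A) u β * properWith (edges B) v (α ∸ᵛ β))
      ≡⟨ ∑-comm (below α) LA _ ⟩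
    ∑[ u ∈ LA ] ∑[ β ∈ below α ] ∑[ v ∈ LB ] (properWith (edges A) u β * properWith (edges B) v (α ∸ᵛ β))
      ≡⟨ ∑-cong LA (λ u → trans (∑-comm (below α) LB _) (∑-cong LB (pair u))) ⟩
    ∑[ u ∈ LA ] ∑[ v ∈ LB ] properWith (edges (A ⊎ᴳ B)) (u V.++ v) α
      ≡⟨ sym (allVecs-++ k (n A) (n B) _) ⟩
    #colourings (n A + n B) (λ c → proper c (edges (A ⊎ᴳ B))) k α ∎

∸-<-+ : ∀ {a b x} → a ≤ x → x < a + b → x ∸ a < b
∸-<-+ {a} {b} {x} a≤x x<a+b = +-cancelˡ-< a (x ∸ a) b (subst (_< a + b) (sym (m+[n∸m]≡n a≤x)) x<a+b)

<-+-cases : ∀ a b {P : ℕ → Set} → (∀ x → x < a → P x) → (∀ m → m < b → P (a + m)) →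
            ∀ x → x < a + b → P x
<-+-cases a b {P} left right x x<a+b with x <? a
... | yes x<a = left x x<a
... | no  x≮a = subst P (m+[n∸m]≡n (≮⇒≥ x≮a)) (right (x ∸ a) (∸-<-+ (≮⇒≥ x≮a) x<a+b))

∸-suc-< : ∀ {w m} → w < m → m ∸ suc w < m
∸-suc-< {w} {suc m} _ = s≤s (m∸n≤m m w)

∸-suc-∸-suc : ∀ {w m} → w < m → m ∸ suc (m ∸ suc w) ≡ w
∸-suc-∸-suc {w} {suc m} (s≤s w≤m) = m∸[m∸n]≡n w≤m

-- Vertex relabellings are written block by block with this; it is opaque so that only the two
-- evaluation lemmas below are used to compute with it.
infixr 4 _⟨_⟩_

opaque
  _⟨_⟩_ : (ℕ → ℕ) → ℕ → (ℕ → ℕ) → ℕ → ℕ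
  (f ⟨ a ⟩ g) x = if x <ᵇ a then f x else g (x ∸ a)

  ⟨⟩-< : ∀ {f g : ℕ → ℕ} {a x} → x < a → (f ⟨ a ⟩ g) x ≡ f x
  ⟨⟩-< x<a = if-true (<ᵇ-true x<a)

  ⟨⟩-+ : ∀ {f g : ℕ → ℕ} a m → (f ⟨ a ⟩ g) (a + m) ≡ g m
  ⟨⟩-+ {g = g} a m = trans (if-false (<ᵇ-false (m≤m+n a m))) (cong g (m+n∸m≡n a m))

all< : ℕ → (ℕ → Bool) → Bool
all< zero    h = true
all< (suc m) h = h 0 ∧ all< m (h ∘ suc)

all<-cong : ∀ m {h h′ : ℕ → Bool} → (∀ i → i < m → h i ≡ h′ i) → all< m h ≡ all< m h′
all<-cong zero    e = refl
all<-cong (suc m) e = cong₂ _∧_ (e 0 z<s) (all<-cong m (λ i p → e (suc i) (s<s p)))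

all<-+ : ∀ a b (h : ℕ → Bool) → all< (a + b) h ≡ all< a h ∧ all< b (λ i → h (a + i))
all<-+ zero    b h = refl
all<-+ (suc a) b h = trans (cong (h 0 ∧_) (all<-+ a b (h ∘ suc))) (sym (∧-assoc (h 0) _ _))

all<-reverse : ∀ m (h : ℕ → Bool) → all< m h ≡ all< m (λ i → h (m ∸ suc i))
all<-reverse zero    h = refl
all<-reverse (suc m) h = begin
  h 0 ∧ all< m (h ∘ suc)
    ≡⟨ cong (h 0 ∧_) (all<-reverse m (h ∘ suc)) ⟩
  h 0 ∧ all< m (λ i → h (suc (m ∸ suc i)))
    ≡⟨ ∧-comm (h 0) _ ⟩
  all< m (λ i → h (suc (m ∸ suc i))) ∧ h 0
    ≡⟨ cong₂ _∧_ (all<-cong m (λ i i<m → cong h (sym (+-∸-assoc 1 i<m)))) (cong h (sym (n∸n≡0 m))) ⟩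
  all< m (λ i → h (suc m ∸ suc i)) ∧ h (suc m ∸ suc m)
    ≡⟨ sym (all<-snoc m (λ i → h (suc m ∸ suc i))) ⟩
  all< (suc m) (λ i → h (suc m ∸ suc i)) ∎
  where
  open ≡-Reasoning
  all<-snoc : ∀ m (h : ℕ → Bool) → all< (suc m) h ≡ all< m h ∧ h m
  all<-snoc m h = trans (subst (λ k → all< k h ≡ all< m h ∧ all< 1 (λ i → h (m + i))) (+-comm m 1) (all<-+ m 1 h))
                        (cong (λ b → all< m h ∧ b) (trans (∧-comm (h (m + 0)) true) (cong h (+-identityʳ m))))

differ-sym : ∀ {k} (c : Colouring k) x y → differ c x y ≡ differ c y x
differ-sym c x y with c x | c y
... | just a  | just b  = cong not (trans (isYes≗does (a ≟ᶠ b))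
                                      (trans (does-⇔ (mk⇔ sym sym) (a ≟ᶠ b) (b ≟ᶠ a))
                                             (sym (isYes≗does (b ≟ᶠ a)))))
... | just _  | nothing = refl
... | nothing | just _  = refl
... | nothing | nothing = refl

properPath : ∀ {k} → Colouring k → ℕ → (ℕ → ℕ) → Bool
properPath c m p = all< m (λ i → differ c (p i) (p (suc i)))

module _ {k : ℕ} (c : Colouring k) where

  proper-pathEdges : ∀ m p → proper c (pathEdges m p) ≡ properPath c m p
  proper-pathEdges m p = go id m
    where
    go : (f : ℕ → ℕ) (m : ℕ) → proper c (map (λ i → p i , p (suc i)) (applyUpTo f m))
                              ≡ all< m (λ i → differ c (p (f i)) (p (suc (f i))))
    go f zero    = refl
    go f (suc m) = cong (differ c (p (f 0)) (p (suc (f 0))) ∧_) (go (f ∘ suc) m)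

  properPath-cong : ∀ m {p q : ℕ → ℕ} → (∀ i → i ≤ m → c (p i) ≡ c (q i)) →
                    properPath c m p ≡ properPath c m q
  properPath-cong m e =
    all<-cong m (λ i i<m → cong₂ (λ a b → not (sameColor a b)) (e i (<⇒≤ i<m)) (e (suc i) i<m))

  properPath-+ : ∀ a b p → properPath c (a + b) p ≡ properPath c a p ∧ properPath c b (λ i → p (a + i))
  properPath-+ a b p = trans (all<-+ a b _)
    (cong (properPath c a p ∧_) (all<-cong b (λ i _ → cong (differ c (p (a + i)) ∘ p) (sym (+-suc a i)))))

  properPath-reverse : ∀ m p → properPath c m p ≡ properPath c m (λ i → p (m ∸ i))
  properPath-reverse m p = trans (all<-reverse m _)
    (all<-cong m (λ i i<m → trans (differ-sym c _ _)
                                  (cong (λ z → differ c (p z) (p (m ∸ suc i))) (sym (+-∸-assoc 1 i<m)))))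

n≡suc-rest : ∀ A → n (graph A) ≡ suc (rest A)
n≡suc-rest A with n (graph A) | root<n A
... | suc m | _ = refl

offset : Rooted → ℕ → ℕ
offset A x = if x <ᵇ root A then x else x ∸ 1

unoffset : Rooted → ℕ → ℕ
unoffset A m = if m <ᵇ root A then m else suc m

module _ (A : Rooted) where

  place-root : ∀ r off → place A r off (root A) ≡ r
  place-root r off = if-true (≡ᵇ-true {root A} refl)

  place-nonroot : ∀ r off x → x ≢ root A → place A r off x ≡ off + offset A x
  place-nonroot r off x x≢root with x <ᵇ root A
  ... | true  = if-false (≡ᵇ-false x≢root)
  ... | false = if-false (≡ᵇ-false x≢root)

  offset<rest : ∀ x → x < n (graph A) → x ≢ root A → offset A x < rest A
  offset<rest x x<n x≢root with x <? root A
  ... | yes x<root rewrite <ᵇ-true x<root = <-≤-trans x<root (≤-pred (subst (root A <_) (n≡suc-rest A) (root<n A)))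
  ... | no  x≮root rewrite <ᵇ-false (≮⇒≥ x≮root) =
    ∸-monoˡ-< x<n (≤-trans (s≤s z≤n) (≤∧≢⇒< (≮⇒≥ x≮root) (x≢root ∘ sym)))

  unoffset-offset : ∀ x → x ≢ root A → unoffset A (offset A x) ≡ x
  unoffset-offset x x≢root with x <? root A
  ... | yes x<root rewrite <ᵇ-true x<root | <ᵇ-true x<root = refl
  ... | no  x≮root = above x (≤∧≢⇒< (≮⇒≥ x≮root) (x≢root ∘ sym))
    where
    above : ∀ x → root A < x → unoffset A (offset A x) ≡ x
    above (suc x) (s≤s root≤x) rewrite <ᵇ-false (≤-trans (n≤1+n (root A)) (s≤s root≤x)) | <ᵇ-false root≤x = refl

  place-< : ∀ r off x T → x < n (graph A) → r < T → off + rest A ≤ T → place A r off x < T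
  place-< r off x T x<n r<T off+rest≤T with x ≟ root A
  ... | yes refl = subst (_< T) (sym (place-root r off)) r<T
  ... | no  x≢root = subst (_< T) (sym (place-nonroot r off x x≢root))
                                (<-≤-trans (+-monoʳ-< off (offset<rest x x<n x≢root)) off+rest≤T)

  place-relabel : ∀ (σ : ℕ → ℕ) r r′ off off′ → σ r ≡ r′ →
                  (∀ m → m < rest A → σ (off + m) ≡ off′ + m) →
                  ∀ x → x < n (graph A) → σ (place A r off x) ≡ place A r′ off′ x
  place-relabel σ r r′ off off′ root↦ rest↦ x x<n with x ≟ root A
  ... | yes refl = trans (cong σ (place-root r off)) (trans root↦ (sym (place-root r′ off′)))
  ... | no  x≢root = trans (cong σ (place-nonroot r off x x≢root))
                     (trans (rest↦ (offset A x) (offset<rest x x<n x≢root)) (sym (place-nonroot r′ off′ x x≢root)))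

  place-left-inverse : ∀ (τ : ℕ → ℕ) r off base → τ r ≡ base + root A →
                       (∀ m → m < rest A → τ (off + m) ≡ base + unoffset A m) →
                       ∀ x → x < n (graph A) → τ (place A r off x) ≡ base + x
  place-left-inverse τ r off base root↤ rest↤ x x<n with x ≟ root A
  ... | yes refl = trans (cong τ (place-root r off)) root↤
  ... | no  x≢root = trans (cong τ (place-nonroot r off x x≢root))
                     (trans (rest↤ (offset A x) (offset<rest x x<n x≢root)) (cong (base +_) (unoffset-offset x x≢root)))

  proper-graph-cong : ∀ {k} {c c′ : Colouring k} → (∀ x → x < n (graph A) → c x ≡ c′ x) →
                      proper c (edges (graph A)) ≡ proper c′ (edges (graph A))
  proper-graph-cong e = proper-cong-on (edges (graph A)) (All.map (λ (p , q , _) → e _ p , e _ q) (simple A))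

  proper-place-relabel : ∀ {k} (c : Colouring k) (σ : ℕ → ℕ) r r′ off off′ → σ r ≡ r′ →
                         (∀ m → m < rest A → σ (off + m) ≡ off′ + m) →
                         proper (c ∘ σ ∘ place A r off) (edges (graph A))
                         ≡ proper (c ∘ place A r′ off′) (edges (graph A))
  proper-place-relabel c σ r r′ off off′ root↦ rest↦ =
    proper-graph-cong (λ x x<n → cong c (place-relabel σ r r′ off off′ root↦ rest↦ x x<n))

pathVertex : Rooted → ℕ → ℕ
pathVertex A zero    = root A
pathVertex A (suc i) = n (graph A) + i

edges-P : ∀ m A B → edges (P m A B) ≡
          edges (graph A) ++ pathEdges m (pathVertex A) ++ placeEdges B (pathVertex A m) (n (graph A) + m)
edges-P zero    A B = refl
edges-P (suc m) A B = cong (λ E → edges (graph A) ++ E ++ placeEdges B (pathVertex A (suc m)) (n (graph A) + suc m))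
                           (map-cong (λ { zero → refl ; (suc i) → refl }) (upTo (suc m)))

module _ {k : ℕ} (c : Colouring k) where

  proper-P : ∀ m A B → proper c (edges (P m A B)) ≡
             proper c (edges (graph A)) ∧ (properPath c m (pathVertex A) ∧
             proper (c ∘ place B (pathVertex A m) (n (graph A) + m)) (edges (graph B)))
  proper-P m A B = begin
    proper c (edges (P m A B))
      ≡⟨ cong (proper c) (edges-P m A B) ⟩
    proper c (edges (graph A) ++ pathEdges m (pathVertex A) ++ placeEdges B _ _)
      ≡⟨ proper-++ c (edges (graph A)) _ ⟩
    proper c (edges (graph A)) ∧ proper c (pathEdges m (pathVertex A) ++ placeEdges B _ _)
      ≡⟨ cong (proper c (edges (graph A)) ∧_) (trans (proper-++ c (pathEdges m (pathVertex A)) _)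
              (cong₂ _∧_ (proper-pathEdges c m (pathVertex A)) (proper-map c _ (edges (graph B))))) ⟩
    proper c (edges (graph A)) ∧ (properPath c m (pathVertex A) ∧ proper (c ∘ place B _ _) (edges (graph B))) ∎
    where open ≡-Reasoning

  proper-Spider : ∀ a b d G₁ G₂ G₃ → proper c (edges (Spider a b d G₁ G₂ G₃)) ≡
    properPath c a (legV 0) ∧ (properPath c b (legV a) ∧ (properPath c d (legV (a + b)) ∧
    (proper (c ∘ place G₁ (legV 0 a) (suc (a + b + d))) (edges (graph G₁)) ∧
    (proper (c ∘ place G₂ (legV a b) (suc (a + b + d) + rest G₁)) (edges (graph G₂)) ∧
     proper (c ∘ place G₃ (legV (a + b) d) (suc (a + b + d) + rest G₁ + rest G₂)) (edges (graph G₃))))))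
  proper-Spider a b d G₁ G₂ G₃ =
    trans (proper-++ c (pathEdges a (legV 0)) _) (cong₂ _∧_ (proper-pathEdges c a _)
    (trans (proper-++ c (pathEdges b (legV a)) _) (cong₂ _∧_ (proper-pathEdges c b _)
    (trans (proper-++ c (pathEdges d (legV (a + b))) _) (cong₂ _∧_ (proper-pathEdges c d _)
    (trans (proper-++ c (placeEdges G₁ _ _) _) (cong₂ _∧_ (proper-map c _ (edges (graph G₁)))
    (trans (proper-++ c (placeEdges G₂ _ _) _) (cong₂ _∧_ (proper-map c _ (edges (graph G₂)))
                                                           (proper-map c _ (edges (graph G₃))))))))))))

P-edgesWithin : ∀ m A B → EdgesWithin (n (P m A B)) (edges (P m A B))
P-edgesWithin m A B = subst (EdgesWithin size) (sym (edges-P m A B))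
  (++⁺ (All.map (λ (p , q , _) → <-≤-trans p nA≤size , <-≤-trans q nA≤size) (simple A))
  (++⁺ (map⁺ (applyUpTo⁺₁ id m (λ {i} i<m → pathVertex< i (<⇒≤ i<m) , pathVertex< (suc i) i<m)))
       (map⁺ (All.map (λ (p , q , _) → place-< B _ _ _ size p (pathVertex< m ≤-refl) ≤-refl ,
                                        place-< B _ _ _ size q (pathVertex< m ≤-refl) ≤-refl) (simple B)))))
  where
  size : ℕ
  size = n (graph A) + m + rest B
  nA≤size : n (graph A) ≤ size
  nA≤size = ≤-trans (m≤m+n _ m) (m≤m+n _ (rest B))
  pathVertex< : ∀ i → i ≤ m → pathVertex A i < size
  pathVertex< zero    _   = <-≤-trans (root<n A) nA≤size
  pathVertex< (suc i) i<m = <-≤-trans (+-monoʳ-< (n (graph A)) i<m) (m≤m+n _ (rest B))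

legV-0 : ∀ i → legV 0 i ≡ i
legV-0 zero    = refl
legV-0 (suc i) = refl

-- Triple deletion

-- In a colouring where x and y share a colour the two sides agree termwise; otherwise both sides
-- are the same two terms.
triple-deletion : ∀ n x y z (W : ∀ {k} → Colouring k → Bool) → x < n → y < n → ∀ k α →
  #colourings n (λ c → differ c x y ∧ (differ c x z ∧ W c)) k α + #colourings n (λ c → differ c y z ∧ W c) k α
  ≡ #colourings n (λ c → differ c x y ∧ (differ c y z ∧ W c)) k α + #colourings n (λ c → differ c x z ∧ W c) k α
triple-deletion n x y z W x<n y<n k α =
  trans (sym (∑-+ (allVecs k n) _ _)) (trans (∑-cong (allVecs k n) termwise) (∑-+ (allVecs k n) _ _))
  where
  swap-if-same : ∀ (xy xz yz w e : Bool) → (xy ≡ false → xz ≡ yz) →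
                 𝟙 ((xy ∧ (xz ∧ w)) ∧ e) + 𝟙 ((yz ∧ w) ∧ e)
                 ≡ 𝟙 ((xy ∧ (yz ∧ w)) ∧ e) + 𝟙 ((xz ∧ w) ∧ e)
  swap-if-same true  xz yz w e _     = +-comm (𝟙 ((xz ∧ w) ∧ e)) _
  swap-if-same false xz yz w e xz≡yz rewrite xz≡yz refl = refl

  same-colour : ∀ {k} (a b : Fin k) w → not (sameColor (just a) (just b)) ≡ false →
                not (sameColor (just a) w) ≡ not (sameColor (just b) w)
  same-colour a b w a~b with a ≟ᶠ b
  ... | yes refl = refl
  same-colour a b w () | no _

  termwise : ∀ κ → counted (λ c → differ c x y ∧ (differ c x z ∧ W c)) α κ
                    + counted (λ c → differ c y z ∧ W c) α κ
                  ≡ counted (λ c → differ c x y ∧ (differ c y z ∧ W c)) α κ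
                    + counted (λ c → differ c x z ∧ W c) α κ
  termwise κ = swap-if-same (differ (at κ) x y) (differ (at κ) x z) (differ (at κ) y z) (W (at κ)) _
    (subst₂ (λ cx cy → not (sameColor cx cy) ≡ false → not (sameColor cx (at κ z)) ≡ not (sameColor cy (at κ z)))
            (sym (at-lookup κ x x<n)) (sym (at-lookup κ y y<n)) (same-colour _ _ (at κ z)))

pos-rearrange : ∀ a b c d → a + d ≡ b + c → ℤ.+ a ≡ ℤ.+ b ℤ.+ (ℤ.+ c ℤ.- ℤ.+ d)
pos-rearrange a b c d a+d≡b+c = begin
  ℤ.+ a                         ≡⟨ add-sub (ℤ.+ a) (ℤ.+ d) ⟩
  ℤ.+ a ℤ.+ ℤ.+ d ℤ.- ℤ.+ d     ≡⟨ cong (ℤ._- ℤ.+ d) (sym (ℤ.pos-+ a d)) ⟩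
  ℤ.+ (a + d) ℤ.- ℤ.+ d         ≡⟨ cong (λ z → ℤ.+ z ℤ.- ℤ.+ d) a+d≡b+c ⟩
  ℤ.+ (b + c) ℤ.- ℤ.+ d         ≡⟨ cong (ℤ._- ℤ.+ d) (ℤ.pos-+ b c) ⟩
  ℤ.+ b ℤ.+ ℤ.+ c ℤ.- ℤ.+ d     ≡⟨ ℤ.+-assoc (ℤ.+ b) (ℤ.+ c) (ℤ.- ℤ.+ d) ⟩
  ℤ.+ b ℤ.+ (ℤ.+ c ℤ.- ℤ.+ d)   ∎
  where
  open ≡-Reasoning
  add-sub : ∀ (x y : ℤ.ℤ) → x ≡ x ℤ.+ y ℤ.- y
  add-sub = solve-∀ℤ

-- The spider step

-- The four graphs of one triple-deletion step on the spider S(g, h′+1, j+1); v₂ and v₃ are the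
-- first vertices of the second and third legs, and the triangle is centre, v₃, v₂.
module SpiderStep (G H J : Rooted) (g h′ j : ℕ) where

  h rG rH rJ N nS v₂ v₃ : ℕ
  h  = suc h′
  rG = rest G
  rH = rest H
  rJ = rest J
  N  = suc (g + h + suc j)
  nS = N + rG + rH + rJ
  v₂ = legV g 1
  v₃ = legV (g + h) 1

  -- Everything of S except the two edges at the centre leading into legs two and three.
  leg₁ leg₂ leg₃ blockG blockH blockJ common : ∀ {k} → Colouring k → Bool
  leg₁   c = properPath c g (legV 0)
  leg₂   c = properPath c h′ (legV g ∘ suc)
  leg₃   c = properPath c j (legV (g + h) ∘ suc)
  blockG c = proper (c ∘ place G (legV 0 g) N) (edges (graph G))
  blockH c = proper (c ∘ place H (legV g h) (N + rG)) (edges (graph H))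
  blockJ c = proper (c ∘ place J (legV (g + h) (suc j)) (N + rG + rH)) (edges (graph J))
  common c = leg₁ c ∧ (leg₂ c ∧ (leg₃ c ∧ (blockG c ∧ (blockH c ∧ blockJ c))))

  v₃<N : v₃ < N
  v₃<N = s≤s (+-monoʳ-≤ (g + h) z<s)

  N≤nS : N ≤ nS
  N≤nS = ≤-trans (m≤m+n N rG) (≤-trans (m≤m+n (N + rG) rH) (m≤m+n (N + rG + rH) rJ))

  v₃<nS : v₃ < nS
  v₃<nS = <-≤-trans v₃<N N≤nS

  X-S : ∀ k α → X (Spider g h (suc j) G H J) k α ≡
        ℤ.+ #colourings nS (λ c → differ c 0 v₃ ∧ (differ c 0 v₂ ∧ common c)) k α
  X-S k α = trans (X≡#colourings (Spider g h (suc j) G H J) k α) (cong ℤ.+_ (#colourings-cong nS reorder k α))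
    where
    reorder : ∀ {k} (c : Colouring k) →
              proper c (edges (Spider g h (suc j) G H J)) ≡ differ c 0 v₃ ∧ (differ c 0 v₂ ∧ common c)
    reorder c = trans (proper-Spider c g h (suc j) G H J)
      (∧-solve (differ c 0 v₃) (differ c 0 v₂) (leg₁ c) (leg₂ c) (leg₃ c) (blockG c) (blockH c) (blockJ c))
      where
      ∧-solve : ∀ e₃ e₂ l₁ l₂ l₃ b₁ b₂ b₃ →
                l₁ ∧ ((e₂ ∧ l₂) ∧ ((e₃ ∧ l₃) ∧ (b₁ ∧ (b₂ ∧ b₃)))) ≡ e₃ ∧ (e₂ ∧ (l₁ ∧ (l₂ ∧ (l₃ ∧ (b₁ ∧ (b₂ ∧ b₃))))))
      ∧-solve = solve 8 (λ e₃ e₂ l₁ l₂ l₃ b₁ b₂ b₃ →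
        l₁ ⊗ ((e₂ ⊗ l₂) ⊗ ((e₃ ⊗ l₃) ⊗ (b₁ ⊗ (b₂ ⊗ b₃))))
        ⊜ e₃ ⊗ (e₂ ⊗ (l₁ ⊗ (l₂ ⊗ (l₃ ⊗ (b₁ ⊗ (b₂ ⊗ b₃))))))) refl

  private
    v₃≡ : v₃ ≡ suc (g + h)
    v₃≡ = +-comm (g + h) 1

    <v₃ : ∀ {i} → i ≤ g + h → i < v₃
    <v₃ {i} i≤ = subst (i <_) (sym v₃≡) (s≤s i≤)

    v₃≤ : ∀ {i} → g + h ≤ i → v₃ ≤ suc i
    v₃≤ {i} ≤i = subst (_≤ suc i) (sym v₃≡) (s≤s ≤i)

    ρ : ℕ → ℕ
    ρ = rotate v₃

    N′ : ℕ
    N′ = suc (suc g + h + j)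

    ρ-N′+ : ∀ m → ρ (N′ + m) ≡ N + m
    ρ-N′+ m = trans (rotate-above v₃ (suc g + h + j + m) (≤-trans (v₃≤ ≤-refl) (s≤s g+h≤)))
                    (cong (λ z → suc (z + m)) (sym (+-suc (g + h) j)))
      where
      g+h≤ : g + h ≤ g + h + j + m
      g+h≤ = ≤-trans (m≤m+n (g + h) j) (m≤m+n (g + h + j) m)

    ρ-N′+-assoc : ∀ a m → ρ (N′ + a + m) ≡ N + a + m
    ρ-N′+-assoc a m = trans (cong ρ (+-assoc N′ a m)) (trans (ρ-N′+ (a + m)) (sym (+-assoc N a m)))

    ρ-leg₃ : ∀ i → ρ (legV (suc g + h) i) ≡ legV (g + h) (suc i)
    ρ-leg₃ zero    = refl
    ρ-leg₃ (suc i) =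
      trans (rotate-above v₃ (g + h + suc i) (subst (v₃ ≤_) (sym (+-suc (g + h) i)) (v₃≤ (m≤m+n (g + h) i))))
            (sym (+-suc (g + h) (suc i)))

  -- rotate v₃ renumbers S(g+1, h, j) with its centre at v₃ and its first leg running through 0 and leg one.
  X-S′ : ∀ k α → X (Spider (suc g) h j G H J) k α ≡
         ℤ.+ #colourings nS (λ c → differ c 0 v₃ ∧ (differ c v₃ v₂ ∧ common c)) k α
  X-S′ k α = trans (X≡#colourings S′ k α)
                   (cong ℤ.+_ (#colourings-relabel-graph S′ size (rotation v₃ nS v₃<nS) rotated k α))
    where
    S′ : Graph
    S′ = Spider (suc g) h j G H J
    size : n S′ ≡ nS
    size = cong (λ z → suc z + rG + rH + rJ) (sym (+-suc (g + h) j))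

    rotated : ∀ {k} (c : Colouring k) →
              proper (c ∘ ρ) (edges S′) ≡ differ c 0 v₃ ∧ (differ c v₃ v₂ ∧ common c)
    rotated c = trans (proper-Spider (c ∘ ρ) (suc g) h j G H J)
      (trans (cong₂ _∧_ new-leg₁ (cong₂ _∧_ new-leg₂ (cong₂ _∧_ new-leg₃
                (cong₂ _∧_ new-G (cong₂ _∧_ new-H new-J)))))
             (∧-solve (differ c 0 v₃) (differ c v₃ v₂) (leg₁ c) (leg₂ c) (leg₃ c) (blockG c) (blockH c) (blockJ c)))
      where
      ∧-solve : ∀ e₃ e₂ l₁ l₂ l₃ b₁ b₂ b₃ →
                (e₃ ∧ l₁) ∧ ((e₂ ∧ l₂) ∧ (l₃ ∧ (b₁ ∧ (b₂ ∧ b₃)))) ≡ e₃ ∧ (e₂ ∧ (l₁ ∧ (l₂ ∧ (l₃ ∧ (b₁ ∧ (b₂ ∧ b₃))))))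
      ∧-solve = solve 8 (λ e₃ e₂ l₁ l₂ l₃ b₁ b₂ b₃ →
        (e₃ ⊗ l₁) ⊗ ((e₂ ⊗ l₂) ⊗ (l₃ ⊗ (b₁ ⊗ (b₂ ⊗ b₃))))
        ⊜ e₃ ⊗ (e₂ ⊗ (l₁ ⊗ (l₂ ⊗ (l₃ ⊗ (b₁ ⊗ (b₂ ⊗ b₃))))))) refl
      new-leg₁ : properPath (c ∘ ρ) (suc g) (legV 0) ≡ differ c 0 v₃ ∧ leg₁ c
      new-leg₁ = cong₂ _∧_ (trans (cong (differ c v₃) (rotate-below v₃ 0 (<v₃ z≤n))) (differ-sym c v₃ 0))
        (properPath-cong c g (λ i i≤g →
          cong c (trans (rotate-below v₃ i (<v₃ (≤-trans i≤g (m≤m+n g h)))) (sym (legV-0 i)))))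
      new-leg₂ : properPath (c ∘ ρ) h (legV (suc g)) ≡ differ c v₃ v₂ ∧ leg₂ c
      new-leg₂ = cong₂ _∧_ (cong (differ c v₃) (rotate-below v₃ (g + 1) (<v₃ (+-monoʳ-≤ g (s≤s z≤n)))))
        (properPath-cong c h′ (λ i i≤h′ →
          cong c (rotate-below v₃ (g + suc i) (<v₃ (+-monoʳ-≤ g (s≤s i≤h′))))))
      new-leg₃ : properPath (c ∘ ρ) j (legV (suc g + h)) ≡ leg₃ c
      new-leg₃ = properPath-cong c j (λ i _ → cong c (ρ-leg₃ i))
      new-G : proper (c ∘ ρ ∘ place G (legV 0 (suc g)) N′) (edges (graph G)) ≡ blockG c
      new-G = proper-place-relabel G c ρ (suc g) (legV 0 g) N′ N
                (trans (rotate-below v₃ g (<v₃ (m≤m+n g h))) (sym (legV-0 g))) (λ m _ → ρ-N′+ m)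
      new-H : proper (c ∘ ρ ∘ place H (legV (suc g) h) (N′ + rG)) (edges (graph H)) ≡ blockH c
      new-H = proper-place-relabel H c ρ (legV (suc g) h) (legV g h) (N′ + rG) (N + rG)
                (rotate-below v₃ (g + h) (<v₃ ≤-refl)) (λ m _ → ρ-N′+-assoc rG m)
      new-J : proper (c ∘ ρ ∘ place J (legV (suc g + h) j) (N′ + rG + rH)) (edges (graph J)) ≡ blockJ c
      new-J = proper-place-relabel J c ρ (legV (suc g + h) j) (legV (g + h) (suc j)) (N′ + rG + rH) (N + rG + rH)
                (ρ-leg₃ j) (λ m _ → trans (cong ρ (+-assoc (N′ + rG) rH m))
                  (trans (ρ-N′+-assoc rG (rH + m)) (sym (+-assoc (N + rG) rH m))))

  -- A map out of the spider's vertex set, given block by block in the order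
  -- centre and leg one, leg two, leg three, and the non-root vertices of G, H, J.
  spiderGlue : (b₀ b₁ b₂ b₃ b₄ b₅ : ℕ → ℕ) → ℕ → ℕ
  spiderGlue b₀ b₁ b₂ b₃ b₄ b₅ = b₀ ⟨ suc g ⟩ (b₁ ⟨ h ⟩ (b₂ ⟨ suc j ⟩ (b₃ ⟨ rG ⟩ (b₄ ⟨ rH ⟩ b₅))))

  module _ (b₀ b₁ b₂ b₃ b₄ b₅ : ℕ → ℕ) where
    private
      glue : ℕ → ℕ
      glue = spiderGlue b₀ b₁ b₂ b₃ b₄ b₅

      shape₂ : ∀ a b m → a + b + suc m ≡ suc a + (b + m)
      shape₂ = solve-∀
      shape₃ : ∀ a b c m → suc (a + b + c) + m ≡ suc a + (b + (c + m))
      shape₃ = solve-∀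
      shape₄ : ∀ a b c d m → suc (a + b + c) + d + m ≡ suc a + (b + (c + (d + m)))
      shape₄ = solve-∀
      shape₅ : ∀ a b c d e m → suc (a + b + c) + d + e + m ≡ suc a + (b + (c + (d + (e + m))))
      shape₅ = solve-∀

    glue-leg₁ : ∀ i → i ≤ g → glue i ≡ b₀ i
    glue-leg₁ i i≤g = ⟨⟩-< (s≤s i≤g)

    glue-leg₂ : ∀ m → m < h → glue (legV g (suc m)) ≡ b₁ m
    glue-leg₂ m m<h = trans (cong glue (+-suc g m)) (trans (⟨⟩-+ (suc g) m) (⟨⟩-< m<h))

    glue-leg₃ : ∀ m → m ≤ j → glue (legV (g + h) (suc m)) ≡ b₂ m
    glue-leg₃ m m≤j = trans (cong glue (shape₂ g h m))
                      (trans (⟨⟩-+ (suc g) (h + m)) (trans (⟨⟩-+ h m) (⟨⟩-< (s≤s m≤j))))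

    glue-G : ∀ m → m < rG → glue (N + m) ≡ b₃ m
    glue-G m m<rG = trans (cong glue (shape₃ g h (suc j) m))
                    (trans (⟨⟩-+ (suc g) _) (trans (⟨⟩-+ h _) (trans (⟨⟩-+ (suc j) m) (⟨⟩-< m<rG))))

    glue-H : ∀ m → m < rH → glue (N + rG + m) ≡ b₄ m
    glue-H m m<rH = trans (cong glue (shape₄ g h (suc j) rG m))
                    (trans (⟨⟩-+ (suc g) _) (trans (⟨⟩-+ h _) (trans (⟨⟩-+ (suc j) _)
                    (trans (⟨⟩-+ rG m) (⟨⟩-< m<rH)))))

    glue-J : ∀ m → glue (N + rG + rH + m) ≡ b₅ m
    glue-J m = trans (cong glue (shape₅ g h (suc j) rG rH m))
               (trans (⟨⟩-+ (suc g) _) (trans (⟨⟩-+ h _) (trans (⟨⟩-+ (suc j) _)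
               (trans (⟨⟩-+ rG _) (⟨⟩-+ rH m)))))

  nG : ℕ
  nG = n (graph G)

  g<N : g < N
  g<N = s≤s (≤-trans (m≤m+n g h) (m≤m+n (g + h) (suc j)))

  -- Reads leg one back as the path of G^g, whose i-th vertex sits at nG + i − 1.
  leg₁↤ : ℕ → ℕ
  leg₁↤ i = if i ≡ᵇ g then root G else nG + (g ∸ suc i)

  leg₁↤-root : leg₁↤ g ≡ root G
  leg₁↤-root = if-true (≡ᵇ-true {g} refl)

  leg₁↤-tail : ∀ {w} → w < g → leg₁↤ (g ∸ suc w) ≡ nG + w
  leg₁↤-tail w<g = trans (if-false (≡ᵇ-false (<⇒≢ (∸-suc-< w<g)))) (cong (nG +_) (∸-suc-∸-suc w<g))

  -- P^{g+h}(G,H) ⊎ J^j is the spider with the edge between the centre and v₃ deleted.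
  module SplitOffJ where

    nJ nA : ℕ
    nJ = n (graph J)
    nA = nG + (g + h) + rH

    R : Graph
    R = P (g + h) G H ⊎ᴳ tailG J j

    size : nA + (nJ + j) ≡ nS
    size rewrite n≡suc-rest G | n≡suc-rest J = arith rG rH rJ g h j
      where
      arith : ∀ a b c d e f → suc a + (d + e) + b + (suc c + f) ≡ suc (d + e + suc f) + a + b + c
      arith = solve-∀

    -- The path of P^{g+h}(G,H) runs from G's root down leg one to the centre and out along leg two;
    -- the tail of J^j runs from J's root down leg three.
    walk₁ walk₃ : ℕ → ℕ
    walk₁ i = if i <ᵇ suc g then g ∸ i else i
    walk₃ i = g + h + (suc j ∸ i)

    toSpider fromSpider : ℕ → ℕ
    toSpider = ((place G (legV 0 g) N ⟨ nG ⟩ (walk₁ ∘ suc)) ⟨ nG + (g + h) ⟩ (λ m → N + rG + m))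
               ⟨ nA ⟩ ((place J (legV (g + h) (suc j)) (N + rG + rH) ⟨ nJ ⟩ (walk₃ ∘ suc)) ⟨ nJ + j ⟩ (nS +_))
    fromSpider = spiderGlue leg₁↤
                            (λ m → nG + (g + m))
                            (λ m → if m ≡ᵇ j then nA + root J else nA + (nJ + (j ∸ suc m)))
                            (unoffset G)
                            (λ m → nG + (g + h) + m)
                            (λ m → nA + unoffset J m)

    toSpider-G : ∀ x → x < nG → toSpider x ≡ place G (legV 0 g) N x
    toSpider-G x x<nG = trans (⟨⟩-< (<-≤-trans x<nG (≤-trans (m≤m+n nG (g + h)) (m≤m+n _ rH))))
                        (trans (⟨⟩-< (<-≤-trans x<nG (m≤m+n nG (g + h)))) (⟨⟩-< x<nG))

    toSpider-path : ∀ w → w < g + h → toSpider (nG + w) ≡ walk₁ (suc w)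
    toSpider-path w w<gh = trans (⟨⟩-< (<-≤-trans (+-monoʳ-< nG w<gh) (m≤m+n _ rH)))
                           (trans (⟨⟩-< (+-monoʳ-< nG w<gh)) (⟨⟩-+ nG w))

    toSpider-H : ∀ m → m < rH → toSpider (nG + (g + h) + m) ≡ N + rG + m
    toSpider-H m m<rH = trans (⟨⟩-< (+-monoʳ-< (nG + (g + h)) m<rH)) (⟨⟩-+ (nG + (g + h)) m)

    toSpider-J : ∀ z → z < nJ → toSpider (nA + z) ≡ place J (legV (g + h) (suc j)) (N + rG + rH) z
    toSpider-J z z<nJ = trans (⟨⟩-+ nA z) (trans (⟨⟩-< (<-≤-trans z<nJ (m≤m+n nJ j))) (⟨⟩-< z<nJ))

    toSpider-tail : ∀ w → w < j → toSpider (nA + (nJ + w)) ≡ walk₃ (suc w)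
    toSpider-tail w w<j = trans (⟨⟩-+ nA (nJ + w)) (trans (⟨⟩-< (+-monoʳ-< nJ w<j)) (⟨⟩-+ nJ w))

    toSpider-beyond : ∀ m → toSpider (nA + (nJ + j + m)) ≡ nS + m
    toSpider-beyond m = trans (⟨⟩-+ nA (nJ + j + m)) (⟨⟩-+ (nJ + j) m)

    walk₁-leg₁ : ∀ i → i ≤ g → walk₁ i ≡ g ∸ i
    walk₁-leg₁ i i≤g = if-true (<ᵇ-true (s≤s i≤g))

    walk₁-leg₂ : ∀ i → g < i → walk₁ i ≡ i
    walk₁-leg₂ i g<i = if-false (<ᵇ-false g<i)

    fromSpider-root-G : fromSpider (legV 0 g) ≡ root G
    fromSpider-root-G = trans (cong fromSpider (legV-0 g)) (trans (glue-leg₁ _ _ _ _ _ _ g ≤-refl) leg₁↤-root)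

    fromSpider-root-J : fromSpider (legV (g + h) (suc j)) ≡ nA + root J
    fromSpider-root-J = trans (glue-leg₃ _ _ _ _ _ _ j ≤-refl) (if-true (≡ᵇ-true {j} refl))

    from-to : ∀ x → x < nS → fromSpider (toSpider x) ≡ x
    from-to x x<nS = <-+-cases nA (nJ + j) {P = λ x → fromSpider (toSpider x) ≡ x}
      (<-+-cases (nG + (g + h)) rH (<-+-cases nG (g + h) G-vertex path-vertex) H-vertex)
      (<-+-cases nJ j J-vertex tail-vertex) x (subst (x <_) (sym size) x<nS)
      where
      G-vertex : ∀ x → x < nG → fromSpider (toSpider x) ≡ x
      G-vertex x x<nG = trans (cong fromSpider (toSpider-G x x<nG))
        (place-left-inverse G fromSpider (legV 0 g) N 0 fromSpider-root-G (glue-G _ _ _ _ _ _) x x<nG)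
      path-vertex : ∀ w → w < g + h → fromSpider (toSpider (nG + w)) ≡ nG + w
      path-vertex w w<gh with w <? g
      ... | yes w<g = begin
        fromSpider (toSpider (nG + w))
          ≡⟨ cong fromSpider (trans (toSpider-path w w<gh) (walk₁-leg₁ (suc w) w<g)) ⟩
        fromSpider (g ∸ suc w)
          ≡⟨ glue-leg₁ _ _ _ _ _ _ (g ∸ suc w) (m∸n≤m g (suc w)) ⟩
        leg₁↤ (g ∸ suc w)
          ≡⟨ leg₁↤-tail w<g ⟩
        nG + w ∎
        where open ≡-Reasoning
      ... | no w≮g = begin
        fromSpider (toSpider (nG + w))
          ≡⟨ cong fromSpider (trans (toSpider-path w w<gh) (walk₁-leg₂ (suc w) (s≤s g≤w))) ⟩
        fromSpider (suc w)
          ≡⟨ cong fromSpider (sym (trans (+-suc g (w ∸ g)) (cong suc (m+[n∸m]≡n g≤w)))) ⟩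
        fromSpider (legV g (suc (w ∸ g)))
          ≡⟨ glue-leg₂ _ _ _ _ _ _ (w ∸ g) (∸-<-+ g≤w w<gh) ⟩
        nG + (g + (w ∸ g))
          ≡⟨ cong (nG +_) (m+[n∸m]≡n g≤w) ⟩
        nG + w ∎
        where
        open ≡-Reasoning
        g≤w : g ≤ w
        g≤w = ≮⇒≥ w≮g
      H-vertex : ∀ m → m < rH → fromSpider (toSpider (nG + (g + h) + m)) ≡ nG + (g + h) + m
      H-vertex m m<rH = trans (cong fromSpider (toSpider-H m m<rH)) (glue-H _ _ _ _ _ _ m m<rH)
      J-vertex : ∀ z → z < nJ → fromSpider (toSpider (nA + z)) ≡ nA + z
      J-vertex z z<nJ = trans (cong fromSpider (toSpider-J z z<nJ))
        (place-left-inverse J fromSpider _ (N + rG + rH) nA fromSpider-root-J (λ m _ → glue-J _ _ _ _ _ _ m) z z<nJ)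
      tail-vertex : ∀ w → w < j → fromSpider (toSpider (nA + (nJ + w))) ≡ nA + (nJ + w)
      tail-vertex w w<j = begin
        fromSpider (toSpider (nA + (nJ + w)))         ≡⟨ cong fromSpider (toSpider-tail w w<j) ⟩
        fromSpider (g + h + (j ∸ w))                  ≡⟨ cong (λ z → fromSpider (g + h + z)) (+-∸-assoc 1 w<j) ⟩
        fromSpider (legV (g + h) (suc (j ∸ suc w)))   ≡⟨ glue-leg₃ _ _ _ _ _ _ (j ∸ suc w) (m∸n≤m j (suc w)) ⟩
        (if j ∸ suc w ≡ᵇ j then nA + root J else nA + (nJ + (j ∸ suc (j ∸ suc w))))
                                                      ≡⟨ if-false (≡ᵇ-false (<⇒≢ (∸-suc-< w<j))) ⟩
        nA + (nJ + (j ∸ suc (j ∸ suc w)))             ≡⟨ cong (λ z → nA + (nJ + z)) (∸-suc-∸-suc w<j) ⟩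
        nA + (nJ + w)                                 ∎
        where open ≡-Reasoning

    walk₁< : ∀ i → i ≤ g + h → walk₁ i < N
    walk₁< i i≤gh with i <? suc g
    ... | yes i≤g = subst (_< N) (sym (walk₁-leg₁ i (s≤s⁻¹ i≤g))) (≤-<-trans (m∸n≤m g i) g<N)
    ... | no  i≰g = subst (_< N) (sym (walk₁-leg₂ i (≮⇒≥ i≰g))) (s≤s (≤-trans i≤gh (m≤m+n (g + h) (suc j))))

    walk₃< : ∀ i → walk₃ i < N
    walk₃< i = s≤s (+-monoʳ-≤ (g + h) (m∸n≤m (suc j) i))

    to-< : ∀ x → x < nS → toSpider x < nS
    to-< x x<nS = <-+-cases nA (nJ + j) {P = λ x → toSpider x < nS}
      (<-+-cases (nG + (g + h)) rH (<-+-cases nG (g + h) G-vertex path-vertex) H-vertex)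
      (<-+-cases nJ j J-vertex tail-vertex) x (subst (x <_) (sym size) x<nS)
      where
      G-vertex : ∀ x → x < nG → toSpider x < nS
      G-vertex x x<nG = subst (_< nS) (sym (toSpider-G x x<nG))
        (place-< G _ N x nS x<nG (subst (_< nS) (sym (legV-0 g)) (<-≤-trans g<N N≤nS))
                 (≤-trans (m≤m+n (N + rG) rH) (m≤m+n _ rJ)))
      path-vertex : ∀ w → w < g + h → toSpider (nG + w) < nS
      path-vertex w w<gh = subst (_< nS) (sym (toSpider-path w w<gh)) (<-≤-trans (walk₁< (suc w) w<gh) N≤nS)
      H-vertex : ∀ m → m < rH → toSpider (nG + (g + h) + m) < nS
      H-vertex m m<rH = subst (_< nS) (sym (toSpider-H m m<rH)) (<-≤-trans (+-monoʳ-< (N + rG) m<rH) (m≤m+n _ rJ))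
      J-vertex : ∀ z → z < nJ → toSpider (nA + z) < nS
      J-vertex z z<nJ = subst (_< nS) (sym (toSpider-J z z<nJ))
                              (place-< J _ _ z nS z<nJ (<-≤-trans (walk₃< 0) N≤nS) ≤-refl)
      tail-vertex : ∀ w → w < j → toSpider (nA + (nJ + w)) < nS
      tail-vertex w w<j = subst (_< nS) (sym (toSpider-tail w w<j)) (<-≤-trans (walk₃< (suc w)) N≤nS)

    to-≥ : ∀ x → nS ≤ x → nS ≤ toSpider x
    to-≥ x nS≤x = subst (nS ≤_) (sym (trans (cong toSpider x≡) (toSpider-beyond (x ∸ nS)))) (m≤m+n nS (x ∸ nS))
      where
      x≡ : x ≡ nA + (nJ + j + (x ∸ nS))
      x≡ = trans (sym (m+[n∸m]≡n nS≤x)) (trans (cong (_+ (x ∸ nS)) (sym size)) (+-assoc nA (nJ + j) (x ∸ nS)))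

    relabelling : Relabelling nS
    relabelling = record { to = toSpider ; from = fromSpider ; to-< = to-< ; to-≥ = to-≥ ; from-to = from-to }

    relabelled : ∀ {k} (c : Colouring k) → proper (c ∘ toSpider) (edges R) ≡ differ c 0 v₂ ∧ common c
    relabelled c = begin
      proper (c ∘ toSpider) (edges R)
        ≡⟨ proper-++ (c ∘ toSpider) (edges (P (g + h) G H)) _ ⟩
      proper (c ∘ toSpider) (edges (P (g + h) G H)) ∧ proper (c ∘ toSpider) (shiftEdges nA (edges (tailG J j)))
        ≡⟨ cong₂ _∧_ (proper-P (c ∘ toSpider) (g + h) G H)
                     (trans (proper-map (c ∘ toSpider) (nA +_) (edges (tailG J j)))
                            (proper-P (c ∘ toSpider ∘ (nA +_)) j J K₁)) ⟩
      (proper (c ∘ toSpider) (edges (graph G)) ∧ (properPath (c ∘ toSpider) (g + h) (pathVertex G) ∧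
         proper (c ∘ toSpider ∘ place H (pathVertex G (g + h)) (nG + (g + h))) (edges (graph H)))) ∧
      (proper (c ∘ toSpider ∘ (nA +_)) (edges (graph J)) ∧
         (properPath (c ∘ toSpider ∘ (nA +_)) j (pathVertex J) ∧ true))
        ≡⟨ cong₂ _∧_ (cong₂ _∧_ G-block (cong₂ _∧_ path H-block)) (cong₂ _∧_ J-block (cong (_∧ true) tail)) ⟩
      (blockG c ∧ ((leg₁ c ∧ (differ c 0 v₂ ∧ leg₂ c)) ∧ blockH c)) ∧ (blockJ c ∧ (leg₃ c ∧ true))
        ≡⟨ ∧-solve (differ c 0 v₂) (leg₁ c) (leg₂ c) (leg₃ c) (blockG c) (blockH c) (blockJ c) ⟩
      differ c 0 v₂ ∧ common c ∎
      where
      open ≡-Reasoning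
      ∧-solve : ∀ e₂ l₁ l₂ l₃ b₁ b₂ b₃ →
                (b₁ ∧ ((l₁ ∧ (e₂ ∧ l₂)) ∧ b₂)) ∧ (b₃ ∧ (l₃ ∧ true)) ≡ e₂ ∧ (l₁ ∧ (l₂ ∧ (l₃ ∧ (b₁ ∧ (b₂ ∧ b₃)))))
      ∧-solve = solve 7 (λ e₂ l₁ l₂ l₃ b₁ b₂ b₃ →
        (b₁ ⊗ ((l₁ ⊗ (e₂ ⊗ l₂)) ⊗ b₂)) ⊗ (b₃ ⊗ (l₃ ⊗ ε)) ⊜ e₂ ⊗ (l₁ ⊗ (l₂ ⊗ (l₃ ⊗ (b₁ ⊗ (b₂ ⊗ b₃)))))) refl

      G-block : proper (c ∘ toSpider) (edges (graph G)) ≡ blockG c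
      G-block = proper-graph-cong G (λ x x<nG → cong c (toSpider-G x x<nG))

      path : properPath (c ∘ toSpider) (g + h) (pathVertex G) ≡ leg₁ c ∧ (differ c 0 v₂ ∧ leg₂ c)
      path = begin
        properPath (c ∘ toSpider) (g + h) (pathVertex G)
          ≡⟨ properPath-cong c (g + h) (λ { zero _ → cong c (trans (toSpider-G (root G) (root<n G))
                                                                 (trans (place-root G (legV 0 g) N) (legV-0 g)))
                                          ; (suc w) w<gh → cong c (toSpider-path w w<gh) }) ⟩
        properPath c (g + h) walk₁
          ≡⟨ properPath-+ c g h walk₁ ⟩
        properPath c g walk₁ ∧ properPath c h (λ i → walk₁ (g + i))
          ≡⟨ cong₂ _∧_ (trans (properPath-reverse c g walk₁) (properPath-cong c g down)) (properPath-cong c h out) ⟩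
        leg₁ c ∧ (differ c 0 v₂ ∧ leg₂ c) ∎
        where
        down : ∀ i → i ≤ g → c (walk₁ (g ∸ i)) ≡ c (legV 0 i)
        down i i≤g = cong c (trans (walk₁-leg₁ (g ∸ i) (m∸n≤m g i)) (trans (m∸[m∸n]≡n i≤g) (sym (legV-0 i))))
        out : ∀ i → i ≤ h → c (walk₁ (g + i)) ≡ c (legV g i)
        out zero    _ = cong c (trans (walk₁-leg₁ (g + 0) (≤-reflexive (+-identityʳ g)))
                                      (trans (cong (g ∸_) (+-identityʳ g)) (n∸n≡0 g)))
        out (suc i) _ = cong c (walk₁-leg₂ (g + suc i) (≤-trans (s≤s (m≤m+n g i)) (≤-reflexive (sym (+-suc g i)))))

      H-block : proper (c ∘ toSpider ∘ place H (pathVertex G (g + h)) (nG + (g + h))) (edges (graph H)) ≡ blockH c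
      H-block = proper-place-relabel H c toSpider _ (legV g h) _ (N + rG) H-root toSpider-H
        where
        H-root : toSpider (pathVertex G (g + h)) ≡ legV g h
        H-root = begin
          toSpider (pathVertex G (g + suc h′))
            ≡⟨ cong (toSpider ∘ pathVertex G) (+-suc g h′) ⟩
          toSpider (nG + (g + h′))
            ≡⟨ toSpider-path (g + h′) (subst (g + h′ <_) (sym (+-suc g h′)) ≤-refl) ⟩
          walk₁ (suc (g + h′))
            ≡⟨ walk₁-leg₂ (suc (g + h′)) (s≤s (m≤m+n g h′)) ⟩
          suc (g + h′)
            ≡⟨ sym (+-suc g h′) ⟩
          legV g h ∎

      J-block : proper (c ∘ toSpider ∘ (nA +_)) (edges (graph J)) ≡ blockJ c
      J-block = proper-graph-cong J (λ z z<nJ → cong c (toSpider-J z z<nJ))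

      tail : properPath (c ∘ toSpider ∘ (nA +_)) j (pathVertex J) ≡ leg₃ c
      tail = begin
        properPath (c ∘ toSpider ∘ (nA +_)) j (pathVertex J)
          ≡⟨ properPath-cong c j (λ { zero _ → cong c (trans (toSpider-J (root J) (root<n J)) (place-root J _ _))
                                    ; (suc w) w<j → cong c (toSpider-tail w w<j) }) ⟩
        properPath c j walk₃
          ≡⟨ properPath-reverse c j walk₃ ⟩
        properPath c j (λ i → walk₃ (j ∸ i))
          ≡⟨ properPath-cong c j (λ i i≤j → cong (λ z → c (g + h + z))
                                   (trans (+-∸-assoc 1 (m∸n≤m j i)) (cong suc (m∸[m∸n]≡n i≤j)))) ⟩
        leg₃ c ∎

    X-split : ∀ k α → (X (P (g + h) G H) ⊛ X (tailG J j)) k α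
                      ≡ ℤ.+ #colourings nS (λ c → differ c 0 v₂ ∧ common c) k α
    X-split k α = trans (X-⊛ (P (g + h) G H) (tailG J j) (P-edgesWithin (g + h) G H) k α)
      (cong ℤ.+_ (#colourings-relabel-graph R (trans (cong (nA +_) (+-identityʳ (nJ + j))) size)
                                              relabelling relabelled k α))

  -- G^g ⊎ P^{h+j}(H,J) is the spider with both centre edges into legs two and three deleted and v₂v₃ added.
  module SplitOffG where

    nH nA nB : ℕ
    nH = n (graph H)
    nA = nG + g
    nB = nH + (h + j) + rJ

    R : Graph
    R = tailG G g ⊎ᴳ P (h + j) H J

    size : nA + nB ≡ nS
    size rewrite n≡suc-rest G | n≡suc-rest H = arith rG rH rJ g h′ j
      where
      arith : ∀ a b c d e f → suc a + d + (suc b + (suc e + f) + c) ≡ suc (d + suc e + suc f) + a + b + c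
      arith = solve-∀

    -- The path of P^{h+j}(H,J) runs from H's root down leg two to v₂, across to v₃ and out along leg three.
    walk₂ : ℕ → ℕ
    walk₂ i = if i <ᵇ suc h′ then g + (h ∸ i) else g + h + (i ∸ h′)

    toSpider fromSpider : ℕ → ℕ
    toSpider = (place G (legV 0 g) N ⟨ nG ⟩ (λ w → g ∸ suc w))
               ⟨ nA ⟩ (((place H (legV g h) (N + rG) ⟨ nH ⟩ (walk₂ ∘ suc))
                         ⟨ nH + (h + j) ⟩ (λ m → N + rG + rH + m))
                        ⟨ nB ⟩ (nS +_))
    fromSpider = spiderGlue leg₁↤
                            (λ m → if m ≡ᵇ h′ then nA + root H else nA + (nH + (h′ ∸ suc m)))
                            (λ m → nA + (nH + (h′ + m)))
                            (unoffset G)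
                            (λ m → nA + unoffset H m)
                            (λ m → nA + (nH + (h + j) + m))

    toSpider-G : ∀ x → x < nG → toSpider x ≡ place G (legV 0 g) N x
    toSpider-G x x<nG = trans (⟨⟩-< (<-≤-trans x<nG (m≤m+n nG g))) (⟨⟩-< x<nG)

    toSpider-tail : ∀ w → w < g → toSpider (nG + w) ≡ g ∸ suc w
    toSpider-tail w w<g = trans (⟨⟩-< (+-monoʳ-< nG w<g)) (⟨⟩-+ nG w)

    toSpider-H : ∀ z → z < nH → toSpider (nA + z) ≡ place H (legV g h) (N + rG) z
    toSpider-H z z<nH = trans (⟨⟩-+ nA z)
      (trans (⟨⟩-< (<-≤-trans z<nH (≤-trans (m≤m+n nH (h + j)) (m≤m+n _ rJ))))
      (trans (⟨⟩-< (<-≤-trans z<nH (m≤m+n nH (h + j)))) (⟨⟩-< z<nH)))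

    toSpider-path : ∀ w → w < h + j → toSpider (nA + (nH + w)) ≡ walk₂ (suc w)
    toSpider-path w w<hj = trans (⟨⟩-+ nA (nH + w))
      (trans (⟨⟩-< (<-≤-trans (+-monoʳ-< nH w<hj) (m≤m+n _ rJ)))
      (trans (⟨⟩-< (+-monoʳ-< nH w<hj)) (⟨⟩-+ nH w)))

    toSpider-J : ∀ m → m < rJ → toSpider (nA + (nH + (h + j) + m)) ≡ N + rG + rH + m
    toSpider-J m m<rJ = trans (⟨⟩-+ nA _) (trans (⟨⟩-< (+-monoʳ-< (nH + (h + j)) m<rJ)) (⟨⟩-+ (nH + (h + j)) m))

    toSpider-beyond : ∀ m → toSpider (nA + (nB + m)) ≡ nS + m
    toSpider-beyond m = trans (⟨⟩-+ nA (nB + m)) (⟨⟩-+ nB m)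

    walk₂-leg₂ : ∀ i → i ≤ h′ → walk₂ i ≡ g + (h ∸ i)
    walk₂-leg₂ i i≤h′ = if-true (<ᵇ-true (s≤s i≤h′))

    walk₂-leg₃ : ∀ i → h′ < i → walk₂ i ≡ g + h + (i ∸ h′)
    walk₂-leg₃ i h′<i = if-false (<ᵇ-false h′<i)

    walk₂-leg₃′ : ∀ m → walk₂ (h′ + suc m) ≡ legV (g + h) (suc m)
    walk₂-leg₃′ m = trans (walk₂-leg₃ (h′ + suc m) (subst (h′ <_) (sym (+-suc h′ m)) (s≤s (m≤m+n h′ m))))
                          (cong (g + h +_) (m+n∸m≡n h′ (suc m)))

    from-to : ∀ x → x < nS → fromSpider (toSpider x) ≡ x
    from-to x x<nS = <-+-cases nA nB {P = λ x → fromSpider (toSpider x) ≡ x}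
      (<-+-cases nG g G-vertex tail-vertex)
      (<-+-cases (nH + (h + j)) rJ (<-+-cases nH (h + j) H-vertex path-vertex) J-vertex) x (subst (x <_) (sym size) x<nS)
      where
      G-vertex : ∀ x → x < nG → fromSpider (toSpider x) ≡ x
      G-vertex x x<nG = trans (cong fromSpider (toSpider-G x x<nG))
        (place-left-inverse G fromSpider (legV 0 g) N 0
          (trans (cong fromSpider (legV-0 g)) (trans (glue-leg₁ _ _ _ _ _ _ g ≤-refl) leg₁↤-root))
          (glue-G _ _ _ _ _ _) x x<nG)
      tail-vertex : ∀ w → w < g → fromSpider (toSpider (nG + w)) ≡ nG + w
      tail-vertex w w<g = trans (cong fromSpider (toSpider-tail w w<g))
                          (trans (glue-leg₁ _ _ _ _ _ _ (g ∸ suc w) (m∸n≤m g (suc w))) (leg₁↤-tail w<g))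
      H-vertex : ∀ z → z < nH → fromSpider (toSpider (nA + z)) ≡ nA + z
      H-vertex z z<nH = trans (cong fromSpider (toSpider-H z z<nH))
        (place-left-inverse H fromSpider (legV g h) (N + rG) nA
          (trans (glue-leg₂ _ _ _ _ _ _ h′ ≤-refl) (if-true (≡ᵇ-true {h′} refl)))
          (glue-H _ _ _ _ _ _) z z<nH)
      path-vertex : ∀ w → w < h + j → fromSpider (toSpider (nA + (nH + w))) ≡ nA + (nH + w)
      path-vertex w w<hj with w <? h′
      ... | yes w<h′ = begin
        fromSpider (toSpider (nA + (nH + w)))
          ≡⟨ cong fromSpider (trans (toSpider-path w w<hj) (walk₂-leg₂ (suc w) w<h′)) ⟩
        fromSpider (g + (h′ ∸ w))
          ≡⟨ cong (λ z → fromSpider (g + z)) (+-∸-assoc 1 w<h′) ⟩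
        fromSpider (legV g (suc (h′ ∸ suc w)))
          ≡⟨ glue-leg₂ _ _ _ _ _ _ (h′ ∸ suc w) (s≤s (m∸n≤m h′ (suc w))) ⟩
        (if h′ ∸ suc w ≡ᵇ h′ then nA + root H else nA + (nH + (h′ ∸ suc (h′ ∸ suc w))))
          ≡⟨ if-false (≡ᵇ-false (<⇒≢ (∸-suc-< w<h′))) ⟩
        nA + (nH + (h′ ∸ suc (h′ ∸ suc w)))
          ≡⟨ cong (λ z → nA + (nH + z)) (∸-suc-∸-suc w<h′) ⟩
        nA + (nH + w) ∎
        where open ≡-Reasoning
      ... | no w≮h′ = begin
        fromSpider (toSpider (nA + (nH + w)))
          ≡⟨ cong fromSpider (trans (toSpider-path w w<hj) (walk₂-leg₃ (suc w) (s≤s h′≤w))) ⟩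
        fromSpider (g + h + (suc w ∸ h′))
          ≡⟨ cong (λ z → fromSpider (g + h + z)) (+-∸-assoc 1 h′≤w) ⟩
        fromSpider (legV (g + h) (suc (w ∸ h′)))
          ≡⟨ glue-leg₃ _ _ _ _ _ _ (w ∸ h′) (s≤s⁻¹ (∸-<-+ h′≤w (subst (w <_) (sym (+-suc h′ j)) w<hj))) ⟩
        nA + (nH + (h′ + (w ∸ h′)))
          ≡⟨ cong (λ z → nA + (nH + z)) (m+[n∸m]≡n h′≤w) ⟩
        nA + (nH + w) ∎
        where
        open ≡-Reasoning
        h′≤w : h′ ≤ w
        h′≤w = ≮⇒≥ w≮h′
      J-vertex : ∀ m → m < rJ → fromSpider (toSpider (nA + (nH + (h + j) + m))) ≡ nA + (nH + (h + j) + m)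
      J-vertex m m<rJ = trans (cong fromSpider (toSpider-J m m<rJ)) (glue-J _ _ _ _ _ _ m)

    walk₂< : ∀ i → i ≤ h + j → walk₂ i < N
    walk₂< i i≤hj with i <? suc h′
    ... | yes i≤h′ = subst (_< N) (sym (walk₂-leg₂ i (s≤s⁻¹ i≤h′)))
                           (s≤s (≤-trans (+-monoʳ-≤ g (m∸n≤m h i)) (m≤m+n (g + h) (suc j))))
    ... | no  i≰h′ = subst (_< N) (sym (walk₂-leg₃ i h′<i)) (s≤s (+-monoʳ-≤ (g + h) i∸h′≤1+j))
      where
      h′<i : h′ < i
      h′<i = ≮⇒≥ i≰h′
      i∸h′≤1+j : i ∸ h′ ≤ suc j
      i∸h′≤1+j = subst (i ∸ h′ ≤_) (trans (+-∸-assoc 1 (m≤m+n h′ j)) (cong suc (m+n∸m≡n h′ j)))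
                       (∸-monoˡ-≤ h′ i≤hj)

    to-< : ∀ x → x < nS → toSpider x < nS
    to-< x x<nS = <-+-cases nA nB {P = λ x → toSpider x < nS}
      (<-+-cases nG g G-vertex tail-vertex)
      (<-+-cases (nH + (h + j)) rJ (<-+-cases nH (h + j) H-vertex path-vertex) J-vertex) x (subst (x <_) (sym size) x<nS)
      where
      G-vertex : ∀ x → x < nG → toSpider x < nS
      G-vertex x x<nG = subst (_< nS) (sym (toSpider-G x x<nG))
        (place-< G _ N x nS x<nG (subst (_< nS) (sym (legV-0 g)) (<-≤-trans g<N N≤nS))
                 (≤-trans (m≤m+n (N + rG) rH) (m≤m+n _ rJ)))
      tail-vertex : ∀ w → w < g → toSpider (nG + w) < nS
      tail-vertex w w<g = subst (_< nS) (sym (toSpider-tail w w<g)) (≤-<-trans (m∸n≤m g (suc w)) (<-≤-trans g<N N≤nS))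
      H-vertex : ∀ z → z < nH → toSpider (nA + z) < nS
      H-vertex z z<nH = subst (_< nS) (sym (toSpider-H z z<nH))
        (place-< H _ _ z nS z<nH (<-≤-trans (walk₂< 0 z≤n) N≤nS) (m≤m+n _ rJ))
      path-vertex : ∀ w → w < h + j → toSpider (nA + (nH + w)) < nS
      path-vertex w w<hj = subst (_< nS) (sym (toSpider-path w w<hj)) (<-≤-trans (walk₂< (suc w) w<hj) N≤nS)
      J-vertex : ∀ m → m < rJ → toSpider (nA + (nH + (h + j) + m)) < nS
      J-vertex m m<rJ = subst (_< nS) (sym (toSpider-J m m<rJ)) (+-monoʳ-< (N + rG + rH) m<rJ)

    to-≥ : ∀ x → nS ≤ x → nS ≤ toSpider x
    to-≥ x nS≤x = subst (nS ≤_) (sym (trans (cong toSpider x≡) (toSpider-beyond (x ∸ nS)))) (m≤m+n nS (x ∸ nS))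
      where
      x≡ : x ≡ nA + (nB + (x ∸ nS))
      x≡ = trans (sym (m+[n∸m]≡n nS≤x)) (trans (cong (_+ (x ∸ nS)) (sym size)) (+-assoc nA nB (x ∸ nS)))

    relabelling : Relabelling nS
    relabelling = record { to = toSpider ; from = fromSpider ; to-< = to-< ; to-≥ = to-≥ ; from-to = from-to }

    relabelled : ∀ {k} (c : Colouring k) → proper (c ∘ toSpider) (edges R) ≡ differ c v₃ v₂ ∧ common c
    relabelled c = begin
      proper (c ∘ toSpider) (edges R)
        ≡⟨ proper-++ (c ∘ toSpider) (edges (tailG G g)) _ ⟩
      proper (c ∘ toSpider) (edges (tailG G g)) ∧ proper (c ∘ toSpider) (shiftEdges (nA + 0) (edges (P (h + j) H J)))
        ≡⟨ cong₂ _∧_ (proper-P (c ∘ toSpider) g G K₁)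
                     (trans (proper-map (c ∘ toSpider) (nA + 0 +_) (edges (P (h + j) H J)))
                            (trans (proper-cong (edges (P (h + j) H J))
                                                (λ x → cong (c ∘ toSpider) (cong (_+ x) (+-identityʳ nA))))
                                   (proper-P (c ∘ toSpider ∘ (nA +_)) (h + j) H J))) ⟩
      (proper (c ∘ toSpider) (edges (graph G)) ∧ (properPath (c ∘ toSpider) g (pathVertex G) ∧ true)) ∧
      (proper (c ∘ toSpider ∘ (nA +_)) (edges (graph H)) ∧ (properPath (c ∘ toSpider ∘ (nA +_)) (h + j) (pathVertex H) ∧
         proper (c ∘ toSpider ∘ (nA +_) ∘ place J (pathVertex H (h + j)) (nH + (h + j))) (edges (graph J))))
        ≡⟨ cong₂ _∧_ (cong₂ _∧_ G-block (cong (_∧ true) tail)) (cong₂ _∧_ H-block (cong₂ _∧_ path J-block)) ⟩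
      (blockG c ∧ (leg₁ c ∧ true)) ∧ (blockH c ∧ ((leg₂ c ∧ (differ c v₃ v₂ ∧ leg₃ c)) ∧ blockJ c))
        ≡⟨ ∧-solve (differ c v₃ v₂) (leg₁ c) (leg₂ c) (leg₃ c) (blockG c) (blockH c) (blockJ c) ⟩
      differ c v₃ v₂ ∧ common c ∎
      where
      open ≡-Reasoning
      ∧-solve : ∀ e l₁ l₂ l₃ b₁ b₂ b₃ →
                (b₁ ∧ (l₁ ∧ true)) ∧ (b₂ ∧ ((l₂ ∧ (e ∧ l₃)) ∧ b₃)) ≡ e ∧ (l₁ ∧ (l₂ ∧ (l₃ ∧ (b₁ ∧ (b₂ ∧ b₃)))))
      ∧-solve = solve 7 (λ e l₁ l₂ l₃ b₁ b₂ b₃ →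
        (b₁ ⊗ (l₁ ⊗ ε)) ⊗ (b₂ ⊗ ((l₂ ⊗ (e ⊗ l₃)) ⊗ b₃)) ⊜ e ⊗ (l₁ ⊗ (l₂ ⊗ (l₃ ⊗ (b₁ ⊗ (b₂ ⊗ b₃)))))) refl

      G-block : proper (c ∘ toSpider) (edges (graph G)) ≡ blockG c
      G-block = proper-graph-cong G (λ x x<nG → cong c (toSpider-G x x<nG))

      tail : properPath (c ∘ toSpider) g (pathVertex G) ≡ leg₁ c
      tail = begin
        properPath (c ∘ toSpider) g (pathVertex G)
          ≡⟨ properPath-cong c g (λ { zero _ → cong c (trans (toSpider-G (root G) (root<n G))
                                                        (trans (place-root G (legV 0 g) N) (legV-0 g)))
                                    ; (suc w) w<g → cong c (toSpider-tail w w<g) }) ⟩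
        properPath c g (g ∸_)
          ≡⟨ properPath-reverse c g (g ∸_) ⟩
        properPath c g (λ i → g ∸ (g ∸ i))
          ≡⟨ properPath-cong c g (λ i i≤g → cong c (trans (m∸[m∸n]≡n i≤g) (sym (legV-0 i)))) ⟩
        leg₁ c ∎

      H-block : proper (c ∘ toSpider ∘ (nA +_)) (edges (graph H)) ≡ blockH c
      H-block = proper-graph-cong H (λ z z<nH → cong c (toSpider-H z z<nH))

      path : properPath (c ∘ toSpider ∘ (nA +_)) (h + j) (pathVertex H) ≡ leg₂ c ∧ (differ c v₃ v₂ ∧ leg₃ c)
      path = begin
        properPath (c ∘ toSpider ∘ (nA +_)) (h + j) (pathVertex H)
          ≡⟨ properPath-cong c (h + j) {p = toSpider ∘ (nA +_) ∘ pathVertex H} {q = walk₂}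
                             (λ { zero _ → cong c (trans (toSpider-H (root H) (root<n H)) (place-root H _ _))
                                ; (suc w) w<hj → cong c (toSpider-path w w<hj) }) ⟩
        properPath c (h + j) walk₂
          ≡⟨ cong (λ m → properPath c m walk₂) (sym (+-suc h′ j)) ⟩
        properPath c (h′ + suc j) walk₂
          ≡⟨ properPath-+ c h′ (suc j) walk₂ ⟩
        properPath c h′ walk₂ ∧
          (differ c (walk₂ (h′ + 0)) (walk₂ (h′ + 1)) ∧ properPath c j (λ i → walk₂ (h′ + suc i)))
          ≡⟨ cong₂ _∧_ down (cong₂ _∧_ across out) ⟩
        leg₂ c ∧ (differ c v₃ v₂ ∧ leg₃ c) ∎
        where
        down : properPath c h′ walk₂ ≡ leg₂ c
        down = trans (properPath-reverse c h′ walk₂) (properPath-cong c h′ (λ i i≤h′ →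
                 cong c (trans (walk₂-leg₂ (h′ ∸ i) (m∸n≤m h′ i))
                               (cong (g +_) (trans (+-∸-assoc 1 (m∸n≤m h′ i)) (cong suc (m∸[m∸n]≡n i≤h′)))))))
        v₂≡ : walk₂ (h′ + 0) ≡ v₂
        v₂≡ = trans (walk₂-leg₂ (h′ + 0) (≤-reflexive (+-identityʳ h′)))
                    (cong (g +_) (trans (cong (h ∸_) (+-identityʳ h′))
                                        (trans (+-∸-assoc 1 {h′} ≤-refl) (cong suc (n∸n≡0 h′)))))
        across : differ c (walk₂ (h′ + 0)) (walk₂ (h′ + 1)) ≡ differ c v₃ v₂
        across = trans (cong₂ (differ c) v₂≡ (walk₂-leg₃′ 0)) (differ-sym c v₂ v₃)
        out : properPath c j (λ i → walk₂ (h′ + suc i)) ≡ leg₃ c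
        out = properPath-cong c j (λ i _ → cong c (walk₂-leg₃′ i))

      J-block : proper (c ∘ toSpider ∘ (nA +_) ∘ place J (pathVertex H (h + j)) (nH + (h + j))) (edges (graph J))
                ≡ blockJ c
      J-block = proper-place-relabel J c (toSpider ∘ (nA +_)) _ (legV (g + h) (suc j)) _ (N + rG + rH)
                  (trans (toSpider-path (h′ + j) ≤-refl) (trans (cong walk₂ (sym (+-suc h′ j))) (walk₂-leg₃′ j)))
                  toSpider-J

    X-split : ∀ k α → (X (tailG G g) ⊛ X (P (h + j) H J)) k α
                      ≡ ℤ.+ #colourings nS (λ c → differ c v₃ v₂ ∧ common c) k α
    X-split k α = trans (X-⊛ (tailG G g) (P (h + j) H J) (P-edgesWithin g G K₁) k α)
      (cong ℤ.+_ (#colourings-relabel-graph R (trans (cong (_+ nB) (+-identityʳ nA)) size) relabelling relabelled k α))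

  splitTerm : Series
  splitTerm = X (P (g + h) G H) ⊛ X (tailG J j) ⊖ X (tailG G g) ⊛ X (P (h + j) H J)

  spider-step : X (Spider g h (suc j) G H J) ≈ X (Spider (suc g) h j G H J) ⊕ splitTerm
  spider-step k α = begin
    X (Spider g h (suc j) G H J) k α
      ≡⟨ X-S k α ⟩
    ℤ.+ #S
      ≡⟨ pos-rearrange #S #S′ #R₁ #R₂ (triple-deletion nS 0 v₃ v₂ common z<s v₃<nS k α) ⟩
    ℤ.+ #S′ ℤ.+ (ℤ.+ #R₁ ℤ.- ℤ.+ #R₂)
      ≡⟨ sym (cong₂ ℤ._+_ (X-S′ k α) (cong₂ ℤ._-_ (SplitOffJ.X-split k α) (SplitOffG.X-split k α))) ⟩
    (X (Spider (suc g) h j G H J) ⊕ splitTerm) k α ∎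
    where
    open ≡-Reasoning
    #S #S′ #R₁ #R₂ : ℕ
    #S  = #colourings nS (λ c → differ c 0 v₃ ∧ (differ c 0 v₂ ∧ common c)) k α
    #S′ = #colourings nS (λ c → differ c 0 v₃ ∧ (differ c v₃ v₂ ∧ common c)) k α
    #R₁ = #colourings nS (λ c → differ c 0 v₂ ∧ common c) k α
    #R₂ = #colourings nS (λ c → differ c v₃ v₂ ∧ common c) k α

-- Moving leg three onto leg one

Σ[1to]-cong : ∀ j {f f′ : ℕ → Series} → (∀ i → f i ≈ f′ i) → Σ[1to j ] f ≈ Σ[1to j ] f′
Σ[1to]-cong zero    e k α = refl
Σ[1to]-cong (suc j) e k α = cong₂ ℤ._+_ (Σ[1to]-cong j e k α) (e (suc j) k α)

Σ[1to]-suc : ∀ j (f : ℕ → Series) → Σ[1to suc j ] f ≈ f 1 ⊕ Σ[1to j ] (f ∘ suc)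
Σ[1to]-suc zero    f k α = ℤ.+-comm ℤ.0ℤ (f 1 k α)
Σ[1to]-suc (suc j) f k α = trans (cong (ℤ._+ f (suc (suc j)) k α) (Σ[1to]-suc j f k α)) (ℤ.+-assoc (f 1 k α) _ _)

module _ (G H J : Rooted) (h′ : ℕ) where

  private
    h : ℕ
    h = suc h′

  correction : ℕ → ℕ → ℕ → Series
  correction g j i =
    X (P (g + h + i ∸ 1) G H) ⊛ X (tailG J (j ∸ i)) ⊖ X (tailG G (g + i ∸ 1)) ⊛ X (P (h + j ∸ i) H J)

  correction-first : ∀ g j → correction g (suc j) 1 ≈ SpiderStep.splitTerm G H J g h′ j
  correction-first g j k α rewrite m+n∸n≡m (g + h) 1 | m+n∸n≡m g 1 | +-suc h′ j = refl

  correction-suc : ∀ g j i → correction g (suc j) (suc i) ≈ correction (suc g) j i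
  correction-suc g j i k α rewrite +-suc (g + h) i | +-suc g i | +-suc h′ j = refl

  spider-transfer : ∀ j g → X (Spider g h j G H J) ≈ X (Spider (g + j) h 0 G H J) ⊕ Σ[1to j ] (correction g j)
  spider-transfer zero    g k α = trans (cong (λ m → X (Spider m h 0 G H J) k α) (sym (+-identityʳ g)))
                                        (sym (ℤ.+-identityʳ _))
  spider-transfer (suc j) g k α = begin
    X (Spider g h (suc j) G H J) k α
      ≡⟨ SpiderStep.spider-step G H J g h′ j k α ⟩
    X (Spider (suc g) h j G H J) k α ℤ.+ split k α
      ≡⟨ cong (ℤ._+ split k α) (spider-transfer j (suc g) k α) ⟩
    X (Spider (suc g + j) h 0 G H J) k α ℤ.+ earlier k α ℤ.+ split k α
      ≡⟨ ℤ-swap (X (Spider (suc g + j) h 0 G H J) k α) (earlier k α) (split k α) ⟩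
    X (Spider (suc g + j) h 0 G H J) k α ℤ.+ (split k α ℤ.+ earlier k α)
      ≡⟨ cong₂ ℤ._+_ (cong (λ m → X (Spider m h 0 G H J) k α) (sym (+-suc g j)))
                     (sym (trans (Σ[1to]-suc j (correction g (suc j)) k α)
                                 (cong₂ ℤ._+_ (correction-first g j k α)
                                              (Σ[1to]-cong j (correction-suc g j) k α)))) ⟩
    X (Spider (g + suc j) h 0 G H J) k α ℤ.+ (Σ[1to suc j ] correction g (suc j)) k α ∎
    where
    open ≡-Reasoning
    split earlier : Series
    split   = SpiderStep.splitTerm G H J g h′ j
    earlier = Σ[1to j ] correction (suc g) j
    ℤ-swap : ∀ (a s d : ℤ.ℤ) → a ℤ.+ s ℤ.+ d ≡ a ℤ.+ (d ℤ.+ s)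
    ℤ-swap = solve-∀ℤ

proposition4p2 : (G H J : Rooted) (g h j : ℕ) → 1 ≤ h →
    X (Spider g h j G H J)
      ≈ X (Spider (g + j) h 0 G H J)
        ⊕ (Σ[1to j ] (λ i →
             X (P (g + h + i ∸ 1) G H) ⊛ X (tailG J (j ∸ i))
             ⊖ X (tailG G (g + i ∸ 1)) ⊛ X (P (h + j ∸ i) H J)))
proposition4p2 G H J g (suc h′) j _ = spider-transfer G H J h′ j g
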